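{- For every non-cyclic $k$-subset $J$ of $[n]$, the central Plücker vector $\eta^J_\bullet=(\eta^J(e_I))_{I\in\binom{[n]}{k}}$ satisfies $$\eta^J_\bullet\equiv\mathfrak{h}_J\pmod{L_{k,n}}.$$
   Context: Fix $2\le k<n$, with indices mod $n$, and set $e_S=\sum_{s\in S}e_s\in\mathbb{R}^n$. Lineality and planar basis. $L_{k,n}=\mathrm{span}\{\sum_{I\ni i}e^I\}\subseteq\mathbb{R}^{\binom{[n]}{k}}$. The planar basis element is $\mathfrak{h}_J=\frac1n\sum_I d(e_J,e_I)e^I$, where $d(e_J,e_I)$ is the minimal number of steps, each adding some $e_i-e_{i+1}$ (mod $n$) and staying among $0/1$ vectors with $k$ ones, from $e_J$ to $e_I$. Decorated ordered set partition. For $J$ not a cyclic interval, its elements form maximal cyclic runs $I_1,\dots,I_d$. Each run $I_a$ is preceded cyclically by a maximal gap $C_a\subseteq[n]\setminus J$, with labeling such that $1\in C_1\cup I_1$ and the blocks in cyclic order. Set $S_a=C_a\cup I_a$ and $r_a=|I_a|$. Central roof function. For $a\in\{1,\dots,d\}$, let $$W_a=\sum_{p=1}^{d}\Big(\sum_{q=1}^{p}r_{a+q}\Big)e_{S_{a+p}},$$ with block indices mod $d$. Set $\eta^J(x)=-\frac1k\min_{1\le a\le d}W_a\cdot x$ for $x\in\mathbb{R}^n$. -}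

module Defs where

open import Data.Bool using (Bool; true; false; not; _∧_; if_then_else_)
open import Data.Nat using (ℕ; zero; suc; _+_; _∸_; _≤_; _<_; _≡ᵇ_; _⊓_)
open import Data.Nat.DivMod using (_%_)
open import Data.List using (List; []; _∷_; foldr; map; upTo)
open import Data.Nat.ListAction using (sum)
open import Data.Vec using (Vec; []; _∷_)
open import Data.Fin.Subset using (Subset)
open import Data.Integer using (+_)
open import Data.Rational using (ℚ; 0ℚ; _/_) renaming (_*_ to _*ℚ_; _+_ to _+ℚ_)
open import Data.Product using (Σ; _×_; ∃)
open import Relation.Binary.PropositionalEquality using (_≡_)

-- Conventions: the ground set [n] = {1,…,n} is represented by the
-- 0-based positions 0,…,n-1 (element i+1 ↦ position i).

-- membership of a position in a subset (positions ≥ n are never members)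
at : ∀ {n} → Subset n → ℕ → Bool
at []       _       = false
at (b ∷ v)  zero    = b
at (b ∷ v)  (suc i) = at v i

set : ∀ {n} → Subset n → ℕ → Bool → Subset n
set []      _       _ = []
set (b ∷ v) zero    c = c ∷ v
set (b ∷ v) (suc i) c = b ∷ set v i c

-- m mod d (with the harmless convention m mod 0 = m)
modn : ℕ → ℕ → ℕ
modn m zero    = m
modn m (suc d) = m % suc d

nxt : ℕ → ℕ → ℕ
nxt n i = if suc i ≡ᵇ n then 0 else suc i

prv : ℕ → ℕ → ℕ
prv n zero    = n ∸ 1
prv n (suc i) = i

sumℕ : ℕ → (ℕ → ℕ) → ℕ
sumℕ n f = sum (map f (upTo n))

sumℚ : ℕ → (ℕ → ℚ) → ℚ
sumℚ n f = foldr _+ℚ_ 0ℚ (map f (upTo n))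

ind : Bool → ℕ
ind true  = 1
ind false = 0

fromℕ : ℕ → ℚ
fromℕ m = (+ m) / 1

-- 1/m for m ≥ 1 (only used with m = k ≥ 2 and m = n ≥ 3)
inv : ℕ → ℚ
inv zero    = 0ℚ
inv (suc m) = (+ 1) / suc m

IsCyclicInterval : (n k : ℕ) → Subset n → Set
IsCyclicInterval n k J =
  Σ ℕ λ i → i < n × (∀ x → x < n →
     (at J x ≡ true → ∃ λ t → t < k × x ≡ modn (i + t) n) ×
     ((∃ λ t → t < k × x ≡ modn (i + t) n) → at J x ≡ true))

-- The distance d(e_J, e_I): one step adds e_i - e_{i+1} (indices mod n)
-- and must stay a 0/1 vector, i.e. position i ∉ v and i+1 ∈ v, and the
-- result has i inserted and i+1 removed.

Step : (n : ℕ) → Subset n → Subset n → Set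
Step n v w =
  Σ ℕ λ i → i < n × at v i ≡ false × at v (nxt n i) ≡ true ×
            w ≡ set (set v i true) (nxt n i) false

data Reach (n : ℕ) : ℕ → Subset n → Subset n → Set where
  done : ∀ {v} → Reach n 0 v v
  step : ∀ {m u v w} → Step n v u → Reach n m u w → Reach n (suc m) v w

IsDist : (n : ℕ) → Subset n → Subset n → ℕ → Set
IsDist n J I m = Reach n m J I × (∀ m′ → Reach n m′ J I → m ≤ m′)

-- the coordinate of the planar basis element 𝔥_J at I, given d(e_J,e_I)
planarCoord : (n : ℕ) → ℕ → ℚ
planarCoord n dJI = inv n *ℚ fromℕ dJI

-- Decorated ordered set partition of J.
-- A block S_a = C_a ∪ I_a starts at a position x ∉ J with x-1 ∈ J
-- (the first position of the gap C_a).

isStart : ∀ {n} → Subset n → ℕ → Bool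
isStart {n} J x = not (at J x) ∧ at J (prv n x)

-- d = number of blocks (= number of maximal cyclic runs of J)
numBlocks : ∀ {n} → Subset n → ℕ
numBlocks {n} J = sumℕ n (λ x → ind (isStart J x))

-- This labels as block 0 (the paper's
-- block 1) the block S_1 that contains element 1 (position 0), and the
-- remaining blocks in cyclic order.
blk : ∀ {n} → Subset n → ℕ → ℕ
blk {n} J x = modn (sumℕ x (λ y → ind (isStart J (suc y)))) (numBlocks J)

runLen : ∀ {n} → Subset n → ℕ → ℕ
runLen {n} J b = sumℕ n (λ x → ind (at J x ∧ (blk J x ≡ᵇ b)))

-- coefficient of e_x in W_a: if x ∈ S_{a+p} (p ∈ {1,…,d}) it is
-- Σ_{q=1}^{p} r_{a+q}   (block indices mod d)
wCoeff : ∀ {n} → Subset n → ℕ → ℕ → ℕ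
wCoeff J a x =
  let d = numBlocks J
      p = suc (modn (blk J x + d ∸ suc a) d)
  in sumℕ p (λ q → runLen J (modn (a + suc q) d))

WdotI : ∀ {n} → Subset n → ℕ → Subset n → ℕ
WdotI {n} J a I = sumℕ n (λ x → ind (at I x) Data.Nat.* wCoeff J a x)

-- min_{0 ≤ a < d} W_a · e_I   (d ≥ 1 whenever 0 < |J| < n)
minW : ∀ {n} → Subset n → Subset n → ℕ
minW J I = foldr _⊓_ (WdotI J 0 I) (map (λ a → WdotI J a I) (upTo (numBlocks J)))

eta : ∀ {n} → ℕ → Subset n → Subset n → ℚ
eta k J I = Data.Rational.- (inv k *ℚ fromℕ (minW J I))

-- Σ_{i ∈ I} c_i  (the I-coordinate of Σ_i c_i Σ_{I ∋ i} e^I ∈ L_{k,n})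
sumOver : ∀ {n} → Subset n → (ℕ → ℚ) → ℚ
sumOver {n} I c = sumℚ n (λ x → if at I x then c x else 0ℚ)

-- Write rank v y for the number of elements of v below position y. A move e_i - e_{i+1}
-- lowers the potential n · rank v y - Σ_z rank v z by at most one, and a greedy path attains
-- this bound, so d(e_J, e_I) = m n + Σ_y (rank I y - rank J y) with m = max_y (rank J y - rank I y).
-- Up to terms linear in I, W_a · e_I is -k (rank J - rank I) evaluated at the (a+1)-st block
-- start of J. As rank J - rank I can only increase along a run of J and only decrease along a
-- gap, its maximum m is attained at a block start, so min_a W_a · e_I is linear in I minus k m.
-- In η^J(e_I) - 𝔥_J(e_I) the two occurrences of m cancel, leaving Σ_{i ∈ I} c_i for some c.

module Submission where

open import Defs
open import Data.Bool using (true; false; _∧_; if_then_else_)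
open import Data.Nat
open import Data.Nat.Properties
open import Data.Nat.DivMod using (_%_; m<n⇒m%n≡m; [m+n]%n≡m%n; n%n≡0)
open import Data.Nat.Solver using (module +-*-Solver)
open import Data.List using (foldr; map; upTo; applyUpTo)
open import Data.List.Properties using (map-applyUpTo)
open import Data.Vec using ([]; _∷_)
open import Data.Fin.Subset using (Subset; ∣_∣)
open import Data.Product using (Σ; _×_; ∃; _,_; proj₁; proj₂)
open import Data.Sum using (_⊎_; inj₁; inj₂)
open import Data.Empty using (⊥-elim)
open import Relation.Nullary using (¬_; yes; no)
open import Relation.Binary.PropositionalEquality
open import Function using (_∘_)
import Data.Integer as ℤ
import Data.Integer.Properties as ℤ
open import Data.Rational as ℚ using (ℚ; _-_; 0ℚ; 1ℚ; toℚᵘ)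
import Data.Rational.Properties as ℚ
open import Data.Rational.Unnormalised as ℚᵘ using (mkℚᵘ; _≃_; *≡*)
import Data.Rational.Unnormalised.Properties as ℚᵘ
open import Algebra.Solver.Ring.AlmostCommutativeRing using (fromCommutativeRing)
import Algebra.Solver.Ring.Simple as Simple

open +-*-Solver using (solve; _:+_; _:*_; _:=_; con)

∑ : ℕ → (ℕ → ℕ) → ℕ
∑ zero    f = 0
∑ (suc n) f = f 0 + ∑ n (f ∘ suc)

sumℕ≡∑ : ∀ n f → sumℕ n f ≡ ∑ n f
sumℕ≡∑ n f = trans (cong (foldr _+_ 0) (map-applyUpTo (λ x → x) f n)) (foldr-applyUpTo n f)
  where
  foldr-applyUpTo : ∀ n f → foldr _+_ 0 (applyUpTo f n) ≡ ∑ n f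
  foldr-applyUpTo zero    f = refl
  foldr-applyUpTo (suc n) f = cong (f 0 +_) (foldr-applyUpTo n (f ∘ suc))

∑-cong : ∀ n {f g} → (∀ x → x < n → f x ≡ g x) → ∑ n f ≡ ∑ n g
∑-cong zero    eq = refl
∑-cong (suc n) eq = cong₂ _+_ (eq 0 z<s) (∑-cong n (λ x x<n → eq (suc x) (s<s x<n)))

∑-suc : ∀ n f → ∑ (suc n) f ≡ ∑ n f + f n
∑-suc zero    f = +-comm (f 0) 0
∑-suc (suc n) f = trans (cong (f 0 +_) (∑-suc n (f ∘ suc))) (sym (+-assoc (f 0) _ _))

∑-distrib-+ : ∀ n f g → ∑ n (λ x → f x + g x) ≡ ∑ n f + ∑ n g
∑-distrib-+ zero    f g = refl
∑-distrib-+ (suc n) f g = trans (cong (f 0 + g 0 +_) (∑-distrib-+ n (f ∘ suc) (g ∘ suc)))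
  (solve 4 (λ a b c d → a :+ b :+ (c :+ d) := a :+ c :+ (b :+ d)) refl (f 0) (g 0) _ _)

∑-distribˡ-* : ∀ n c f → ∑ n (λ x → c * f x) ≡ c * ∑ n f
∑-distribˡ-* zero    c f = sym (*-zeroʳ c)
∑-distribˡ-* (suc n) c f =
  trans (cong (c * f 0 +_) (∑-distribˡ-* n c (f ∘ suc))) (sym (*-distribˡ-+ c (f 0) _))

∑-const : ∀ n c → ∑ n (λ _ → c) ≡ n * c
∑-const zero    c = refl
∑-const (suc n) c = cong (c +_) (∑-const n c)

∑-zero : ∀ n {f} → (∀ x → x < n → f x ≡ 0) → ∑ n f ≡ 0
∑-zero n eq = trans (∑-cong n eq) (trans (∑-const n 0) (*-zeroʳ n))

∑-split : ∀ m o f → ∑ (m + o) f ≡ ∑ m f + ∑ o (λ q → f (m + q))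
∑-split zero    o f = refl
∑-split (suc m) o f = trans (cong (f 0 +_) (∑-split m o (f ∘ suc))) (sym (+-assoc (f 0) _ _))

∑-mono-≤ : ∀ n {f g} → (∀ x → x < n → f x ≤ g x) → ∑ n f ≤ ∑ n g
∑-mono-≤ zero    le = z≤n
∑-mono-≤ (suc n) le = +-mono-≤ (le 0 z<s) (∑-mono-≤ n (λ x x<n → le (suc x) (s<s x<n)))

f≤∑ : ∀ n f x → x < n → f x ≤ ∑ n f
f≤∑ (suc n) f zero    _         = m≤m+n (f 0) _
f≤∑ (suc n) f (suc x) (s<s x<n) = ≤-trans (f≤∑ n (f ∘ suc) x x<n) (m≤n+m _ (f 0))

∑-≤-prefix : ∀ {m o} f → m ≤ o → ∑ m f ≤ ∑ o f
∑-≤-prefix {m} f m≤o with m≤n⇒∃[o]m+o≡n m≤o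
... | r , refl = ≤-trans (m≤m+n _ _) (≤-reflexive (sym (∑-split m r f)))

∑-mono-≤-rigid : ∀ n {f g} → (∀ x → x < n → f x ≤ g x) → ∑ n f ≡ ∑ n g →
                 ∀ x → x < n → f x ≡ g x
∑-mono-≤-rigid (suc n) {f} {g} le eq x x<n =
  case x x<n
  where
  tail≤ : ∑ n (f ∘ suc) ≤ ∑ n (g ∘ suc)
  tail≤ = ∑-mono-≤ n (λ y y<n → le (suc y) (s<s y<n))
  head≡ : f 0 ≡ g 0
  head≡ = ≤-antisym (le 0 z<s)
    (+-cancelʳ-≤ (∑ n (g ∘ suc)) _ _ (≤-trans (≤-reflexive (sym eq)) (+-monoʳ-≤ (f 0) tail≤)))
  case : ∀ x → x < suc n → f x ≡ g x
  case zero    _         = head≡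
  case (suc x) (s<s x<n) =
    ∑-mono-≤-rigid n (λ y y<n → le (suc y) (s<s y<n)) (+-cancelˡ-≡ (f 0) _ _ (trans eq (cong (_+ _) (sym head≡)))) x x<n

ind≤1 : ∀ b → ind b ≤ 1
ind≤1 true  = s≤s z≤n
ind≤1 false = z≤n

ind-injective : ∀ {a b} → ind a ≡ ind b → a ≡ b
ind-injective {true}  {true}  _ = refl
ind-injective {false} {false} _ = refl

ind-∧ : ∀ p q → ind (p ∧ q) ≡ ind p * ind q
ind-∧ true  q = sym (+-identityʳ (ind q))
ind-∧ false q = refl

ind-≡ᵇ-refl : ∀ a → ind (a ≡ᵇ a) ≡ 1
ind-≡ᵇ-refl zero    = refl
ind-≡ᵇ-refl (suc a) = ind-≡ᵇ-refl a

ind-≡ᵇ-≢ : ∀ {a b} → a ≢ b → ind (a ≡ᵇ b) ≡ 0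
ind-≡ᵇ-≢ {zero}  {zero}  a≢b = ⊥-elim (a≢b refl)
ind-≡ᵇ-≢ {zero}  {suc b} a≢b = refl
ind-≡ᵇ-≢ {suc a} {zero}  a≢b = refl
ind-≡ᵇ-≢ {suc a} {suc b} a≢b = ind-≡ᵇ-≢ (a≢b ∘ cong suc)

ind-<ᵇ-< : ∀ {a b} → a < b → ind (a <ᵇ b) ≡ 1
ind-<ᵇ-< {zero}  {suc b} _         = refl
ind-<ᵇ-< {suc a} {suc b} (s<s a<b) = ind-<ᵇ-< a<b

ind-<ᵇ-≥ : ∀ {a b} → b ≤ a → ind (a <ᵇ b) ≡ 0
ind-<ᵇ-≥ {a}     {zero}  _         = refl
ind-<ᵇ-≥ {suc a} {suc b} (s≤s b≤a) = ind-<ᵇ-≥ b≤a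

ind-<ᵇ-suc : ∀ a m → ind (a <ᵇ suc m) ≡ ind (a <ᵇ m) + ind (a ≡ᵇ m)
ind-<ᵇ-suc zero    zero    = refl
ind-<ᵇ-suc zero    (suc m) = refl
ind-<ᵇ-suc (suc a) zero    = sym (cong (_+ ind (suc a ≡ᵇ 0)) (ind-<ᵇ-≥ {suc a} z≤n))
ind-<ᵇ-suc (suc a) (suc m) = ind-<ᵇ-suc a m

ind-<ᵇ-pred : ∀ {i y} → y ≢ suc i → ind (i <ᵇ y) ≡ ind (suc i <ᵇ y)
ind-<ᵇ-pred {i}     {zero}        _     = refl
ind-<ᵇ-pred {zero}  {suc zero}    y≢si  = ⊥-elim (y≢si refl)
ind-<ᵇ-pred {zero}  {suc (suc y)} _     = refl
ind-<ᵇ-pred {suc i} {suc y}       y≢si  = ind-<ᵇ-pred (y≢si ∘ cong suc)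

∑-select : ∀ n c (f : ℕ → ℕ) → c < n → ∑ n (λ x → ind (x ≡ᵇ c) * f x) ≡ f c
∑-select (suc n) zero    f _         =
  trans (cong₂ _+_ (+-identityʳ (f 0)) (trans (∑-const n 0) (*-zeroʳ n))) (+-identityʳ (f 0))
∑-select (suc n) (suc c) f (s<s c<n) = ∑-select n c (f ∘ suc) c<n

∑-fibres : ∀ m n (h g : ℕ → ℕ) →
  ∑ m (λ b → ∑ n (λ y → h y * ind (g y ≡ᵇ b))) ≡ ∑ n (λ y → h y * ind (g y <ᵇ m))
∑-fibres zero    n h g = sym (∑-zero n (λ y _ → trans (cong (h y *_) (ind-<ᵇ-≥ {g y} z≤n)) (*-zeroʳ (h y))))
∑-fibres (suc m) n h g = begin
    ∑ (suc m) fibre                                                          ≡⟨ ∑-suc m fibre ⟩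
    ∑ m fibre + fibre m                                                      ≡⟨ cong (_+ fibre m) (∑-fibres m n h g) ⟩
    ∑ n (λ y → h y * ind (g y <ᵇ m)) + fibre m                               ≡⟨ ∑-distrib-+ n _ _ ⟨
    ∑ n (λ y → h y * ind (g y <ᵇ m) + h y * ind (g y ≡ᵇ m))                  ≡⟨ ∑-cong n (λ y _ → merge y) ⟩
    ∑ n (λ y → h y * ind (g y <ᵇ suc m))                                     ∎
  where
  open ≡-Reasoning
  fibre : ℕ → ℕ
  fibre b = ∑ n (λ y → h y * ind (g y ≡ᵇ b))
  merge : ∀ y → h y * ind (g y <ᵇ m) + h y * ind (g y ≡ᵇ m) ≡ h y * ind (g y <ᵇ suc m)
  merge y = trans (sym (*-distribˡ-+ (h y) _ _)) (cong (h y *_) (sym (ind-<ᵇ-suc (g y) m)))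

∑-truncate : ∀ n c f → c ≤ n → ∑ n (λ x → f x * ind (x <ᵇ c)) ≡ ∑ c f
∑-truncate n c f c≤n with m≤n⇒∃[o]m+o≡n c≤n
... | r , refl = trans (∑-split c r _) (trans (cong₂ _+_ below above) (+-identityʳ _))
  where
  below : ∑ c (λ x → f x * ind (x <ᵇ c)) ≡ ∑ c f
  below = ∑-cong c (λ x x<c → trans (cong (f x *_) (ind-<ᵇ-< x<c)) (*-identityʳ _))
  above : ∑ r (λ q → f (c + q) * ind (c + q <ᵇ c)) ≡ 0
  above = ∑-zero r (λ q _ → trans (cong (f (c + q) *_) (ind-<ᵇ-≥ (m≤m+n c q))) (*-zeroʳ (f (c + q))))

rank : ∀ {n} → Subset n → ℕ → ℕ
rank v y = ∑ y (ind ∘ at v)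

rankSum : ∀ {n} → Subset n → ℕ
rankSum {n} v = ∑ n (rank v)

∑∈ : ∀ {n} → Subset n → (ℕ → ℕ) → ℕ
∑∈ {n} v f = ∑ n (λ x → ind (at v x) * f x)

module _ {n} (v : Subset n) where

  rank-suc : ∀ y → rank v (suc y) ≡ rank v y + ind (at v y)
  rank-suc y = ∑-suc y (ind ∘ at v)

  rank-mono : ∀ {y z} → y ≤ z → rank v y ≤ rank v z
  rank-mono = ∑-≤-prefix (ind ∘ at v)

  rank-suc-≤ : ∀ y → rank v (suc y) ≤ rank v y + 1
  rank-suc-≤ y = ≤-trans (≤-reflexive (rank-suc y)) (+-monoʳ-≤ (rank v y) (ind≤1 (at v y)))

  rank-≤ : ∀ y → rank v y ≤ y
  rank-≤ zero    = z≤n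
  rank-≤ (suc y) = ≤-trans (rank-suc-≤ y) (≤-trans (+-monoˡ-≤ 1 (rank-≤ y)) (≤-reflexive (+-comm y 1)))

  rank-full : (∀ z → z < n → at v z ≡ true) → ∀ y → y ≤ n → rank v y ≡ y
  rank-full full zero    _   = refl
  rank-full full (suc y) y<n = trans (rank-suc y)
    (trans (cong₂ _+_ (rank-full full y (<⇒≤ y<n)) (cong ind (full y y<n))) (+-comm y 1))

  rank-empty : ∀ y → (∀ z → z < y → at v z ≡ false) → rank v y ≡ 0
  rank-empty y empty = ∑-zero y (λ z z<y → cong ind (empty z z<y))

  ∑∈-cong : ∀ {f g} → (∀ x → x < n → f x ≡ g x) → ∑∈ v f ≡ ∑∈ v g
  ∑∈-cong eq = ∑-cong n (λ x x<n → cong (ind (at v x) *_) (eq x x<n))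

  ∑∈-distrib-+ : ∀ f g → ∑∈ v (λ x → f x + g x) ≡ ∑∈ v f + ∑∈ v g
  ∑∈-distrib-+ f g = trans (∑-cong n (λ x _ → *-distribˡ-+ (ind (at v x)) (f x) (g x))) (∑-distrib-+ n _ _)

  ∑∈-distribˡ-* : ∀ c f → ∑∈ v (λ x → c * f x) ≡ c * ∑∈ v f
  ∑∈-distribˡ-* c f = trans (∑-cong n (λ x _ → *-comm-middle x)) (∑-distribˡ-* n c _)
    where
    *-comm-middle : ∀ x → ind (at v x) * (c * f x) ≡ c * (ind (at v x) * f x)
    *-comm-middle x = solve 3 (λ i c f → i :* (c :* f) := c :* (i :* f)) refl (ind (at v x)) c (f x)

  ∑∈-const : ∀ c → ∑∈ v (λ _ → c) ≡ rank v n * c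
  ∑∈-const c = trans (∑-cong n (λ x _ → *-comm (ind (at v x)) c)) (trans (∑-distribˡ-* n c _) (*-comm c _))

  ∑∈-<ᵇ : ∀ c → c ≤ n → ∑∈ v (λ x → ind (x <ᵇ c)) ≡ rank v c
  ∑∈-<ᵇ c = ∑-truncate n c (ind ∘ at v)

∣∣≡rank : ∀ {n} (v : Subset n) → ∣ v ∣ ≡ rank v n
∣∣≡rank []          = refl
∣∣≡rank (true ∷ v)  = cong suc (∣∣≡rank v)
∣∣≡rank (false ∷ v) = ∣∣≡rank v

-- Each element x of v is counted by rank v y for the n - 1 - x values y > x.
rankSum≡∑∈ : ∀ {n} (v : Subset n) → rankSum v ≡ ∑∈ v (λ x → n ∸ suc x)
rankSum≡∑∈ {n} v = ∑-prefixes n (ind ∘ at v)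
  where
  ∑-prefixes : ∀ m f → ∑ m (λ y → ∑ y f) ≡ ∑ m (λ x → f x * (m ∸ suc x))
  ∑-prefixes zero    f = refl
  ∑-prefixes (suc m) f = begin
      ∑ (suc m) (λ y → ∑ y f)                                 ≡⟨ ∑-suc m _ ⟩
      ∑ m (λ y → ∑ y f) + ∑ m f                               ≡⟨ cong (_+ ∑ m f) (∑-prefixes m f) ⟩
      ∑ m (λ x → f x * (m ∸ suc x)) + ∑ m f                   ≡⟨ ∑-distrib-+ m _ _ ⟨
      ∑ m (λ x → f x * (m ∸ suc x) + f x)                     ≡⟨ ∑-cong m shift ⟩
      ∑ m (λ x → f x * (suc m ∸ suc x))                       ≡⟨ +-identityʳ _ ⟨
      ∑ m (λ x → f x * (suc m ∸ suc x)) + 0                   ≡⟨ cong (∑ m (λ x → f x * (suc m ∸ suc x)) +_) (trans (cong (f m *_) (n∸n≡0 m)) (*-zeroʳ (f m))) ⟨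
      ∑ m (λ x → f x * (suc m ∸ suc x)) + f m * (suc m ∸ suc m) ≡⟨ ∑-suc m _ ⟨
      ∑ (suc m) (λ x → f x * (suc m ∸ suc x))                 ∎
    where
    open ≡-Reasoning
    shift : ∀ x → x < m → f x * (m ∸ suc x) + f x ≡ f x * (suc m ∸ suc x)
    shift x x<m = trans (+-comm _ (f x)) (trans (sym (*-suc (f x) _)) (cong (f x *_) (sym (+-∸-assoc 1 x<m))))

at-set-same : ∀ {n} (v : Subset n) {i} b → i < n → at (set v i b) i ≡ b
at-set-same (c ∷ v) {zero}  b _         = refl
at-set-same (c ∷ v) {suc i} b (s<s i<n) = at-set-same v b i<n

at-set-other : ∀ {n} (v : Subset n) {i} b {j} → j ≢ i → at (set v i b) j ≡ at v j
at-set-other []      b         j≢i = refl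
at-set-other (c ∷ v) {zero}  b {zero}  j≢i = ⊥-elim (j≢i refl)
at-set-other (c ∷ v) {zero}  b {suc j} j≢i = refl
at-set-other (c ∷ v) {suc i} b {zero}  j≢i = refl
at-set-other (c ∷ v) {suc i} b {suc j} j≢i = at-set-other v b (j≢i ∘ cong suc)

Subset-ext : ∀ {n} {v w : Subset n} → (∀ x → x < n → at v x ≡ at w x) → v ≡ w
Subset-ext {v = []}    {[]}    eq = refl
Subset-ext {v = b ∷ v} {c ∷ w} eq = cong₂ _∷_ (eq 0 z<s) (Subset-ext (λ x x<n → eq (suc x) (s<s x<n)))

nxt-last : ∀ {n i} → suc i ≡ n → nxt n i ≡ 0
nxt-last {i = i} refl rewrite ind-injective {suc i ≡ᵇ suc i} (ind-≡ᵇ-refl i) = refl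

nxt-inner : ∀ {n i} → suc i < n → nxt n i ≡ suc i
nxt-inner {n} {i} si<n rewrite ind-injective {suc i ≡ᵇ n} {false} (ind-≡ᵇ-≢ {suc i} {n} (λ { refl → <-irrefl refl si<n })) = refl

exchange : ∀ {n} → Subset n → ℕ → ℕ → Subset n
exchange v i j = set (set v i true) j false

module Exchange {n} (v : Subset n) {i j} (i≢j : i ≢ j) (i<n : i < n) (j<n : j < n)
                (i∉v : at v i ≡ false) (j∈v : at v j ≡ true) where

  private
    u = exchange v i j

  at-exchange-i : at u i ≡ true
  at-exchange-i = trans (at-set-other (set v i true) false i≢j) (at-set-same v true i<n)

  at-exchange-j : at u j ≡ false
  at-exchange-j = at-set-same (set v i true) false j<n

  at-exchange-other : ∀ {x} → x ≢ i → x ≢ j → at u x ≡ at v x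
  at-exchange-other x≢i x≢j = trans (at-set-other (set v i true) false x≢j) (at-set-other v true x≢i)

  exchange-back : exchange u j i ≡ v
  exchange-back = Subset-ext pointwise
    where
    pointwise : ∀ x → x < n → at (exchange u j i) x ≡ at v x
    pointwise x _ with x ≟ i | x ≟ j
    ... | yes refl | _        = trans (at-set-same (set u j true) false i<n) (sym i∉v)
    ... | no x≢i   | yes refl = trans (at-set-other (set u j true) false x≢i) (trans (at-set-same u true j<n) (sym j∈v))
    ... | no x≢i   | no x≢j   = trans (at-set-other (set u j true) false x≢i)
                                  (trans (at-set-other u true x≢j) (at-exchange-other x≢i x≢j))

  ∑∈-exchange : ∀ f → ∑∈ u f + f j ≡ ∑∈ v f + f i
  ∑∈-exchange f = begin
      ∑∈ u f + f j                                                 ≡⟨ cong (∑∈ u f +_) (∑-select n j f j<n) ⟨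
      ∑∈ u f + ∑ n (λ x → ind (x ≡ᵇ j) * f x)                      ≡⟨ ∑-distrib-+ n _ _ ⟨
      ∑ n (λ x → ind (at u x) * f x + ind (x ≡ᵇ j) * f x)          ≡⟨ ∑-cong n (λ x _ → pointwise x) ⟩
      ∑ n (λ x → ind (at v x) * f x + ind (x ≡ᵇ i) * f x)          ≡⟨ ∑-distrib-+ n _ _ ⟩
      ∑∈ v f + ∑ n (λ x → ind (x ≡ᵇ i) * f x)                      ≡⟨ cong (∑∈ v f +_) (∑-select n i f i<n) ⟩
      ∑∈ v f + f i                                                 ∎
    where
    open ≡-Reasoning
    pointwise : ∀ x → ind (at u x) * f x + ind (x ≡ᵇ j) * f x ≡ ind (at v x) * f x + ind (x ≡ᵇ i) * f x
    pointwise x with x ≟ i | x ≟ j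
    ... | yes refl | _        rewrite at-exchange-i | i∉v | ind-≡ᵇ-refl x | ind-≡ᵇ-≢ i≢j = +-comm (f x + 0) 0
    ... | no x≢i   | yes refl rewrite at-exchange-j | j∈v | ind-≡ᵇ-refl x | ind-≡ᵇ-≢ x≢i = +-comm 0 (f x + 0)
    ... | no x≢i   | no x≢j   rewrite at-exchange-other x≢i x≢j | ind-≡ᵇ-≢ x≢i | ind-≡ᵇ-≢ x≢j = refl

  rank-exchange : ∀ y → y ≤ n → rank u y + ind (j <ᵇ y) ≡ rank v y + ind (i <ᵇ y)
  rank-exchange y y≤n = begin
      rank u y + ind (j <ᵇ y)                   ≡⟨ cong (_+ ind (j <ᵇ y)) (∑∈-<ᵇ u y y≤n) ⟨
      ∑∈ u (λ x → ind (x <ᵇ y)) + ind (j <ᵇ y)   ≡⟨ ∑∈-exchange (λ x → ind (x <ᵇ y)) ⟩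
      ∑∈ v (λ x → ind (x <ᵇ y)) + ind (i <ᵇ y)   ≡⟨ cong (_+ ind (i <ᵇ y)) (∑∈-<ᵇ v y y≤n) ⟩
      rank v y + ind (i <ᵇ y)                   ∎
    where open ≡-Reasoning

  rank-exchange-total : rank u n ≡ rank v n
  rank-exchange-total = +-cancelʳ-≡ _ _ _
    (trans (rank-exchange n ≤-refl) (cong (rank v n +_) (trans (ind-<ᵇ-< i<n) (sym (ind-<ᵇ-< j<n)))))

  rankSum-exchange : rankSum u + (n ∸ suc j) ≡ rankSum v + (n ∸ suc i)
  rankSum-exchange = begin
      rankSum u + (n ∸ suc j)              ≡⟨ cong (_+ (n ∸ suc j)) (rankSum≡∑∈ u) ⟩
      ∑∈ u (λ x → n ∸ suc x) + (n ∸ suc j)  ≡⟨ ∑∈-exchange (λ x → n ∸ suc x) ⟩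
      ∑∈ v (λ x → n ∸ suc x) + (n ∸ suc i)  ≡⟨ cong (_+ (n ∸ suc i)) (rankSum≡∑∈ v) ⟨
      rankSum v + (n ∸ suc i)              ∎
    where open ≡-Reasoning

data Move {n} (v : Subset n) : Subset n → Set where
  shift : ∀ i → suc i < n → at v i ≡ false → at v (suc i) ≡ true → Move v (exchange v i (suc i))
  wrap  : ∀ i → suc i ≡ n → at v i ≡ false → at v 0 ≡ true → Move v (exchange v i 0)

step⇒move : ∀ {n} {v u : Subset n} → Step n v u → Move v u
step⇒move {n} {v} (i , i<n , i∉v , next∈v , refl) with m≤n⇒m<n∨m≡n i<n
... | inj₁ si<n rewrite nxt-inner si<n = shift i si<n i∉v next∈v
... | inj₂ si≡n rewrite nxt-last si≡n  = wrap i si≡n i∉v next∈v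

move⇒step : ∀ {n} {v u : Subset n} → Move v u → Step n v u
move⇒step {n} {v} (shift i si<n i∉v si∈v) =
  i , <-trans (n<1+n i) si<n , i∉v , subst (λ j → at v j ≡ true) (sym (nxt-inner si<n)) si∈v ,
  cong (exchange v i) (sym (nxt-inner si<n))
move⇒step {n} {v} (wrap i si≡n i∉v 0∈v) =
  i , ≤-reflexive si≡n , i∉v , subst (λ j → at v j ≡ true) (sym (nxt-last si≡n)) 0∈v ,
  cong (exchange v i) (sym (nxt-last si≡n))

module ShiftMove {n} (v : Subset n) {i} (si<n : suc i < n) (i∉v : at v i ≡ false) (si∈v : at v (suc i) ≡ true) where

  open Exchange v (λ i≡si → 1+n≢n (sym i≡si)) (<-trans (n<1+n i) si<n) si<n i∉v si∈v public

  rankSum-shift : rankSum (exchange v i (suc i)) ≡ rankSum v + 1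
  rankSum-shift = +-cancelʳ-≡ _ _ _ (begin
      rankSum (exchange v i (suc i)) + (n ∸ suc (suc i))   ≡⟨ rankSum-exchange ⟩
      rankSum v + (n ∸ suc i)                              ≡⟨ cong (rankSum v +_) (+-∸-assoc 1 si<n) ⟩
      rankSum v + suc (n ∸ suc (suc i))                    ≡⟨ +-assoc (rankSum v) 1 _ ⟨
      rankSum v + 1 + (n ∸ suc (suc i))                    ∎)
    where open ≡-Reasoning

  rank-shift-at : rank (exchange v i (suc i)) (suc i) ≡ rank v (suc i) + 1
  rank-shift-at = begin
      rank (exchange v i (suc i)) (suc i)                             ≡⟨ +-identityʳ _ ⟨
      rank (exchange v i (suc i)) (suc i) + 0                         ≡⟨ cong (rank (exchange v i (suc i)) (suc i) +_) (ind-<ᵇ-≥ {suc i} ≤-refl) ⟨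
      rank (exchange v i (suc i)) (suc i) + ind (suc i <ᵇ suc i)      ≡⟨ rank-exchange (suc i) (<⇒≤ si<n) ⟩
      rank v (suc i) + ind (i <ᵇ suc i)                               ≡⟨ cong (rank v (suc i) +_) (ind-<ᵇ-< (n<1+n i)) ⟩
      rank v (suc i) + 1                                              ∎
    where open ≡-Reasoning

  rank-shift-other : ∀ y → y ≤ n → y ≢ suc i → rank (exchange v i (suc i)) y ≡ rank v y
  rank-shift-other y y≤n y≢si = +-cancelʳ-≡ _ _ _
    (trans (rank-exchange y y≤n) (cong (rank v y +_) (ind-<ᵇ-pred y≢si)))

  rank-shift-≤ : ∀ x → x ≤ n → rank v x ≤ rank (exchange v i (suc i)) x
  rank-shift-≤ x x≤n with x ≟ suc i
  ... | yes refl = ≤-trans (m≤m+n _ 1) (≤-reflexive (sym rank-shift-at))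
  ... | no x≢si  = ≤-reflexive (sym (rank-shift-other x x≤n x≢si))

module WrapMove {n} (v : Subset n) {i} (si≡n : suc i ≡ n) (i∉v : at v i ≡ false) (0∈v : at v 0 ≡ true) where

  i≢0 : i ≢ 0
  i≢0 refl with trans (sym i∉v) 0∈v
  ... | ()

  open Exchange v i≢0 (≤-reflexive si≡n) (subst (0 <_) si≡n z<s) i∉v 0∈v public

  rankSum-wrap : rankSum (exchange v i 0) + i ≡ rankSum v
  rankSum-wrap = begin
      rankSum (exchange v i 0) + i         ≡⟨ cong (λ m → rankSum (exchange v i 0) + (m ∸ 1)) si≡n ⟩
      rankSum (exchange v i 0) + (n ∸ 1)   ≡⟨ rankSum-exchange ⟩
      rankSum v + (n ∸ suc i)              ≡⟨ cong (λ m → rankSum v + (m ∸ suc i)) si≡n ⟨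
      rankSum v + (suc i ∸ suc i)          ≡⟨ cong (rankSum v +_) (n∸n≡0 i) ⟩
      rankSum v + 0                        ≡⟨ +-identityʳ _ ⟩
      rankSum v                            ∎
    where open ≡-Reasoning

  rank-wrap : ∀ y → 0 < y → y ≤ i → rank (exchange v i 0) y + 1 ≡ rank v y
  rank-wrap y@(suc _) _ y≤i = begin
      rank (exchange v i 0) y + 1             ≡⟨ rank-exchange y (≤-trans y≤i (≤-trans (n≤1+n i) (≤-reflexive si≡n))) ⟩
      rank v y + ind (i <ᵇ y)                 ≡⟨ cong (rank v y +_) (ind-<ᵇ-≥ y≤i) ⟩
      rank v y + 0                            ≡⟨ +-identityʳ _ ⟩
      rank v y                                ∎
    where open ≡-Reasoning

-- The potential n · rank v x - rankSum v drops by at most one per move.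
move-potential : ∀ {n} {v u : Subset n} → Move v u → ∀ x → x < n →
                 n * rank v x + rankSum u ≤ n * rank u x + rankSum v + 1
move-potential {n} {v} (shift i si<n i∉v si∈v) x x<n = begin
    n * rank v x + rankSum (exchange v i (suc i))       ≡⟨ cong (n * rank v x +_) rankSum-shift ⟩
    n * rank v x + (rankSum v + 1)                      ≡⟨ +-assoc (n * rank v x) _ _ ⟨
    n * rank v x + rankSum v + 1                        ≤⟨ +-monoˡ-≤ 1 (+-monoˡ-≤ _ (*-monoʳ-≤ n (rank-shift-≤ x (<⇒≤ x<n)))) ⟩
    n * rank (exchange v i (suc i)) x + rankSum v + 1   ∎
  where
  open ≤-Reasoning
  open ShiftMove v si<n i∉v si∈v
move-potential {n} {v} (wrap i si≡n i∉v 0∈v) zero _ rewrite *-zeroʳ n =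
  ≤-trans (m≤m+n _ i) (≤-trans (≤-reflexive rankSum-wrap) (m≤m+n _ 1))
  where open WrapMove v si≡n i∉v 0∈v
move-potential {n} {v} (wrap i si≡n i∉v 0∈v) x@(suc _) x<n = ≤-reflexive (begin
    n * rank v x + rankSum u                  ≡⟨ cong (λ r → n * r + rankSum u) (rank-wrap x z<s x≤i) ⟨
    n * (rank u x + 1) + rankSum u            ≡⟨ cong (λ m → m * (rank u x + 1) + rankSum u) si≡n ⟨
    suc i * (rank u x + 1) + rankSum u        ≡⟨ solve 3 (λ i r s → (con 1 :+ i) :* (r :+ con 1) :+ s
                                                       := (con 1 :+ i) :* r :+ (s :+ i) :+ con 1) refl i (rank u x) (rankSum u) ⟩
    suc i * rank u x + (rankSum u + i) + 1    ≡⟨ cong₂ (λ m s → m * rank u x + s + 1) si≡n rankSum-wrap ⟩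
    n * rank u x + rankSum v + 1              ∎)
  where
  open ≡-Reasoning
  open WrapMove v si≡n i∉v 0∈v
  u = exchange v i 0
  x≤i : x ≤ i
  x≤i = ≤-pred (≤-trans x<n (≤-reflexive (sym si≡n)))

-- Transitivity for inequalities between differences: A - B ≤ Q - P ≤ D - C.
difference-≤-trans : ∀ {A B C D P Q} → A + P ≤ Q + B → Q + C ≤ D + P → A + C ≤ D + B
difference-≤-trans {A} {B} {C} {D} {P} {Q} h₁ h₂ = +-cancelʳ-≤ (P + Q) _ _ (begin
    A + C + (P + Q)        ≡⟨ solve 4 (λ A C P Q → A :+ C :+ (P :+ Q) := (A :+ P) :+ (Q :+ C)) refl A C P Q ⟩
    (A + P) + (Q + C)      ≤⟨ +-mono-≤ h₁ h₂ ⟩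
    (Q + B) + (D + P)      ≡⟨ solve 4 (λ B D P Q → (Q :+ B) :+ (D :+ P) := D :+ B :+ (P :+ Q)) refl B D P Q ⟩
    D + B + (P + Q)        ∎)
  where open ≤-Reasoning

reach-potential : ∀ {n m} {v w : Subset n} → Reach n m v w → ∀ x → x < n →
                  n * rank v x + rankSum w ≤ n * rank w x + rankSum v + m
reach-potential done x x<n = ≤-reflexive (sym (+-identityʳ _))
reach-potential {n} {suc m} {v} {w} (step {u = u} s r) x x<n =
  ≤-trans (difference-≤-trans {B = rankSum v + 1} {D = n * rank w x + m} {P = rankSum u} {Q = n * rank u x}
            (≤-trans (move-potential (step⇒move s) x x<n) (≤-reflexive (+-assoc (n * rank u x) _ 1)))
            (≤-trans (reach-potential r x x<n)
              (≤-reflexive (solve 3 (λ a b c → a :+ b :+ c := a :+ c :+ b) refl (n * rank w x) (rankSum u) m))))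
          (≤-reflexive (solve 3 (λ a b c → a :+ c :+ (b :+ con 1) := a :+ b :+ (con 1 :+ c)) refl (n * rank w x) (rankSum v) m))

max< : ℕ → (ℕ → ℕ) → ℕ
max< zero    f = 0
max< (suc n) f = f 0 ⊔ max< n (f ∘ suc)

max<-ub : ∀ n f x → x < n → f x ≤ max< n f
max<-ub (suc n) f zero    _         = m≤m⊔n _ _
max<-ub (suc n) f (suc x) (s<s x<n) = ≤-trans (max<-ub n (f ∘ suc) x x<n) (m≤n⊔m _ _)

max<-attained : ∀ n f → ∃ λ x → x < suc n × f x ≡ max< (suc n) f
max<-attained zero    f = 0 , z<s , sym (⊔-identityʳ (f 0))
max<-attained (suc n) f with ≤-total (max< (suc n) (f ∘ suc)) (f 0)
... | inj₁ rest≤f0 = 0 , z<s , sym (m≥n⇒m⊔n≡m rest≤f0)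
... | inj₂ f0≤rest with max<-attained n (f ∘ suc)
...   | x , x<n , fx≡ = suc x , s<s x<n , trans fx≡ (sym (m≤n⇒m⊔n≡n f0≤rest))

IsExcess : ∀ {n} → Subset n → Subset n → ℕ → Set
IsExcess {n} J I m = (∀ x → x < n → rank J x ≤ rank I x + m) × (∃ λ x → x < n × rank J x ≡ rank I x + m)

excess-exists : ∀ {n} (J I : Subset n) → 0 < n → ∃ (IsExcess J I)
excess-exists {suc n} J I _ = m , bound , attained
  where
  gap : ℕ → ℕ
  gap x = rank J x ∸ rank I x
  m = max< (suc n) gap
  bound : ∀ x → x < suc n → rank J x ≤ rank I x + m
  bound x x<n = ≤-trans (m≤n+m∸n (rank J x) (rank I x)) (+-monoʳ-≤ (rank I x) (max<-ub (suc n) gap x x<n))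
  attained : ∃ λ x → x < suc n × rank J x ≡ rank I x + m
  attained with max<-attained n gap
  ... | x , x<n , gap≡m with ≤-total (rank I x) (rank J x)
  ...   | inj₁ I≤J = x , x<n , trans (sym (m+[n∸m]≡n I≤J)) (cong (rank I x +_) gap≡m)
  ...   | inj₂ J≤I = 0 , z<s , cong (0 +_) (trans (sym (m≤n⇒m∸n≡0 J≤I)) gap≡m)

excess-≤-reach : ∀ {n d m} {J I : Subset n} → IsExcess J I m → Reach n d J I → m * n + rankSum I ≤ rankSum J + d
excess-≤-reach {n} {d} {m} {J} {I} (_ , x , x<n , attained) r = +-cancelˡ-≤ (n * rank I x) _ _ (begin
    n * rank I x + (m * n + rankSum I)     ≡⟨ solve 4 (λ n a m s → n :* a :+ (m :* n :+ s) := n :* (a :+ m) :+ s) refl n (rank I x) m (rankSum I) ⟩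
    n * (rank I x + m) + rankSum I         ≡⟨ cong (λ r → n * r + rankSum I) attained ⟨
    n * rank J x + rankSum I               ≤⟨ reach-potential r x x<n ⟩
    n * rank I x + rankSum J + d           ≡⟨ +-assoc (n * rank I x) _ _ ⟩
    n * rank I x + (rankSum J + d)         ∎)
  where open ≤-Reasoning

∑-<-witness : ∀ n {f g} → ∑ n f < ∑ n g → ∃ λ x → x < n × f x < g x
∑-<-witness (suc n) {f} {g} lt with f 0 <? g 0
... | yes f0<g0 = 0 , z<s , f0<g0
... | no  f0≮g0 with ∑-<-witness n {f ∘ suc} {g ∘ suc} (+-cancelˡ-< (g 0) _ _ (≤-<-trans (+-monoˡ-≤ _ (≮⇒≥ f0≮g0)) lt))
...   | x , x<n , fx<gx = suc x , s<s x<n , fx<gx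

rank-injective : ∀ {n} {v w : Subset n} → (∀ x → x ≤ n → rank v x ≡ rank w x) → v ≡ w
rank-injective {n} {v} {w} eq = Subset-ext (λ x x<n → ind-injective (+-cancelˡ-≡ (rank v x) _ _ (begin
    rank v x + ind (at v x)     ≡⟨ rank-suc v x ⟨
    rank v (suc x)              ≡⟨ eq (suc x) x<n ⟩
    rank w (suc x)              ≡⟨ rank-suc w x ⟩
    rank w x + ind (at w x)     ≡⟨ cong (_+ ind (at w x)) (eq x (<⇒≤ x<n)) ⟨
    rank v x + ind (at w x)     ∎)))
  where open ≡-Reasoning

reach-snoc : ∀ {n m} {v u w : Subset n} → Reach n m v u → Step n u w → Reach n (suc m) v w
reach-snoc done       s′ = step s′ done
reach-snoc (step s r) s′ = step s (reach-snoc r s′)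

module Predecessors {n} (J I : Subset n) where

  -- Undoing a move at such a site keeps the excess m (shift) or lowers it to m - 1 (wrap).
  data PredecessorSite (m : ℕ) : Set where
    shift-site : ∀ i → suc i < n → at I i ≡ true → at I (suc i) ≡ false →
                 rank J (suc i) < rank I (suc i) + m → PredecessorSite m
    wrap-site  : ∀ i → suc i ≡ n → at I i ≡ true → at I 0 ≡ false → 0 < m → PredecessorSite m

  crossing : ∀ c {a} b → a < b → rank I a + c ≤ rank J a → rank J b < rank I b + c →
             ∃ λ y → y < b × at I y ≡ true × rank J (suc y) < rank I (suc y) + c
  crossing c {a} (suc b) a<sb tight slack with rank J b <? rank I b + c
  ... | yes slack-b with a ≟ b
  ...   | yes refl = ⊥-elim (<⇒≱ slack-b tight)
  ...   | no a≢b with crossing c b (≤∧≢⇒< (≤-pred a<sb) a≢b) tight slack-b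
  ...     | y , y<b , y∈I , slack-y = y , <-trans y<b (n<1+n b) , y∈I , slack-y
  crossing c {a} (suc b) a<sb tight slack | no b-tight with at I b in b∈I
  ... | true  = b , n<1+n b , b∈I , slack
  ... | false = ⊥-elim (<⇒≱ slack (begin
        rank I (suc b) + c              ≡⟨ cong (_+ c) (trans (rank-suc I b) (cong (λ t → rank I b + ind t) b∈I)) ⟩
        rank I b + 0 + c                ≡⟨ cong (_+ c) (+-identityʳ _) ⟩
        rank I b + c                    ≤⟨ ≮⇒≥ b-tight ⟩
        rank J b                        ≤⟨ rank-mono J (n≤1+n b) ⟩
        rank J (suc b)                  ∎))
    where open ≤-Reasoning

  -- Along a run of I, rank I grows at least as fast as rank J, so the slack persists.
  climb : ∀ c f y → suc (y + f) ≡ n → at I y ≡ true → rank J (suc y) < rank I (suc y) + c →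
          PredecessorSite c ⊎ ((∀ z → y ≤ z → z < n → at I z ≡ true) × rank J n < rank I n + c)
  climb c zero y y+1≡n y∈I slack rewrite +-identityʳ y =
    inj₂ ((λ z y≤z z<n → subst (λ x → at I x ≡ true) (≤-antisym y≤z (≤-pred (≤-trans z<n (≤-reflexive (sym y+1≡n))))) y∈I) ,
          subst (λ x → rank J x < rank I x + c) y+1≡n slack)
  climb c (suc f) y fuel y∈I slack with at I (suc y) in sy∈I
  ... | false = inj₁ (shift-site y sy<n y∈I sy∈I slack)
    where
    sy<n : suc y < n
    sy<n = ≤-trans (s≤s (s≤s (m≤m+n y f))) (≤-reflexive (trans (cong suc (sym (+-suc y f))) fuel))
  ... | true with climb c f (suc y) (trans (cong suc (sym (+-suc y f))) fuel) sy∈I slack-sy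
    where
    slack-sy : rank J (suc (suc y)) < rank I (suc (suc y)) + c
    slack-sy = begin-strict
      rank J (suc (suc y))                    ≤⟨ rank-suc-≤ J (suc y) ⟩
      rank J (suc y) + 1                      <⟨ +-monoˡ-< 1 slack ⟩
      rank I (suc y) + c + 1                  ≡⟨ solve 2 (λ r c → r :+ c :+ con 1 := r :+ con 1 :+ c) refl (rank I (suc y)) c ⟩
      rank I (suc y) + 1 + c                  ≡⟨ cong (λ t → rank I (suc y) + ind t + c) sy∈I ⟨
      rank I (suc y) + ind (at I (suc y)) + c ≡⟨ cong (_+ c) (rank-suc I (suc y)) ⟨
      rank I (suc (suc y)) + c                ∎
      where open ≤-Reasoning
  ...   | inj₁ site          = inj₁ site
  ...   | inj₂ (run , final) = inj₂ (run′ , final)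
    where
    run′ : ∀ z → y ≤ z → z < n → at I z ≡ true
    run′ z y≤z z<n with m≤n⇒m<n∨m≡n y≤z
    ... | inj₁ y<z  = run z y<z z<n
    ... | inj₂ refl = y∈I

  private
    fuel : ∀ {y} → y < n → suc (y + (n ∸ suc y)) ≡ n
    fuel = m+[n∸m]≡n

  site-exists : ∀ {k m} → rank J n ≡ k → rank I n ≡ k → k < n → IsExcess J I m →
                rankSum J < m * n + rankSum I → PredecessorSite m
  site-exists {k} {zero} |J| |I| k<n _ lt with ∑-<-witness n lt
  ... | zero      , _   , ()
  ... | x@(suc _) , x<n , J<I
      with crossing 0 x z<s z≤n (≤-trans J<I (≤-reflexive (sym (+-identityʳ _))))
  ...   | y , y<x , y∈I , slack with climb 0 (n ∸ suc y) y (fuel (<-trans y<x x<n)) y∈I slack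
  ...     | inj₁ site           = site
  ...     | inj₂ (_ , slack-n)  =
              ⊥-elim (<-irrefl refl (subst₂ _<_ |J| (trans (+-identityʳ _) |I|) slack-n))
  site-exists {k} {suc m} |J| |I| k<n (_ , x , x<n , attained) lt with at I 0 in 0∈I
  ... | true with climb (suc m) (n ∸ 1) 0 (fuel 0<n) 0∈I slack-1
    where
    0<n : 0 < n
    0<n = ≤-<-trans z≤n k<n
    slack-1 : rank J 1 < rank I 1 + suc m
    slack-1 = ≤-<-trans (rank-≤ J 1)
                (subst (λ r → 1 < r + suc m) (sym (cong (λ t → ind t + 0) 0∈I)) (s<s z<s))
  ...   | inj₁ site       = site
  ...   | inj₂ (full , _) = ⊥-elim (<-irrefl (trans (sym |I|) (rank-full I (λ z z<n → full z z≤n z<n) n ≤-refl)) k<n)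
  site-exists {k} {suc m} |J| |I| k<n (_ , x , x<n , attained) lt | false
      with crossing (suc m) n x<n (≤-reflexive (sym attained)) slack-n
    where
    slack-n : rank J n < rank I n + suc m
    slack-n = subst₂ (λ a b → a < b + suc m) (sym |J|) (sym |I|) (≤-<-trans (m≤m+n k 0) (+-monoʳ-< k z<s))
  ... | y , y<n , y∈I , slack with climb (suc m) (n ∸ suc y) y (fuel y<n) y∈I slack
  ...   | inj₁ site      = site
  ...   | inj₂ (run , _) = wrap-site (pred n) last (run (pred n) (<⇒≤pred y<n) (≤-reflexive last)) 0∈I z<s
    where
    last : suc (pred n) ≡ n
    last = suc-pred n {{>-nonZero (≤-<-trans z≤n k<n)}}

  record Predecessor (m : ℕ) : Set where
    field
      source    : Subset n
      excess    : ℕ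
      move      : Move source I
      isExcess  : IsExcess J source excess
      size      : rank source n ≡ rank I n
      potential : excess * n + rankSum source + 1 ≡ m * n + rankSum I

  shift-predecessor : ∀ {m} → IsExcess J I m → ∀ i → suc i < n → at I i ≡ true → at I (suc i) ≡ false →
                      rank J (suc i) < rank I (suc i) + m → Predecessor m
  shift-predecessor {m} (bound , x , x<n , attained) i si<n i∈I si∉I slack = record
    { source    = v
    ; excess    = m
    ; move      = subst (Move v) back (shift i si<n i∉v si∈v)
    ; isExcess  = bound′ , attained′
    ; size      = E.rank-exchange-total
    ; potential = trans (+-assoc (m * n) _ 1) (cong (m * n +_) (sym rankSum-I))
    }
    where
    module E = Exchange I {suc i} {i} 1+n≢n si<n (<-trans (n<1+n i) si<n) si∉I i∈I
    v     = exchange I (suc i) i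
    i∉v   = E.at-exchange-j
    si∈v  = E.at-exchange-i
    back  = E.exchange-back
    module S = ShiftMove v si<n i∉v si∈v
    rank-at : rank I (suc i) ≡ rank v (suc i) + 1
    rank-at = trans (cong (λ w → rank w (suc i)) (sym back)) S.rank-shift-at
    rank-other : ∀ y → y ≤ n → y ≢ suc i → rank I y ≡ rank v y
    rank-other y y≤n y≢si = trans (cong (λ w → rank w y) (sym back)) (S.rank-shift-other y y≤n y≢si)
    rankSum-I : rankSum I ≡ rankSum v + 1
    rankSum-I = trans (cong rankSum (sym back)) S.rankSum-shift
    bound′ : ∀ y → y < n → rank J y ≤ rank v y + m
    bound′ y y<n with y ≟ suc i
    ... | yes refl = ≤-pred (≤-trans slack (≤-reflexive
                       (trans (cong (_+ m) rank-at) (trans (+-assoc (rank v (suc i)) 1 m) (+-suc (rank v (suc i)) m)))))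
    ... | no y≢si  = ≤-trans (bound y y<n) (≤-reflexive (cong (_+ m) (rank-other y (<⇒≤ y<n) y≢si)))
    attained′ : ∃ λ y → y < n × rank J y ≡ rank v y + m
    attained′ with x ≟ suc i
    ... | yes refl = ⊥-elim (<-irrefl attained slack)
    ... | no x≢si  = x , x<n , trans attained (cong (_+ m) (rank-other x (<⇒≤ x<n) x≢si))

  wrap-predecessor : ∀ {m} → IsExcess J I m → ∀ i → suc i ≡ n → at I i ≡ true → at I 0 ≡ false → 0 < m →
                     Predecessor m
  wrap-predecessor {suc m} (bound , x , x<n , attained) i si≡n i∈I 0∉I _ = record
    { source    = v
    ; excess    = m
    ; move      = subst (Move v) back (wrap i si≡n i∉v 0∈v)
    ; isExcess  = bound′ , attained′ x x<n attained
    ; size      = E.rank-exchange-total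
    ; potential = trans (cong (λ s → m * n + s + 1) (sym rankSum-I))
        (subst (λ l → m * l + (rankSum I + i) + 1 ≡ suc m * l + rankSum I) si≡n
          (solve 3 (λ m i s → m :* (con 1 :+ i) :+ (s :+ i) :+ con 1 := (con 1 :+ m) :* (con 1 :+ i) :+ s)
            refl m i (rankSum I)))
    }
    where
    open ≡-Reasoning
    i≢0 : i ≢ 0
    i≢0 refl with trans (sym i∈I) 0∉I
    ... | ()
    module E = Exchange I {0} {i} (i≢0 ∘ sym) (subst (0 <_) si≡n z<s) (≤-reflexive si≡n) 0∉I i∈I
    v    = exchange I 0 i
    i∉v  = E.at-exchange-j
    0∈v  = E.at-exchange-i
    back = E.exchange-back
    module W = WrapMove v si≡n i∉v 0∈v
    rankSum-I : rankSum I + i ≡ rankSum v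
    rankSum-I = trans (cong (λ w → rankSum w + i) (sym back)) W.rankSum-wrap
    rank-I : ∀ y → 0 < y → y < n → rank I y + suc m ≡ rank v y + m
    rank-I y 0<y y<n = begin
      rank I y + suc m      ≡⟨ +-suc (rank I y) m ⟩
      suc (rank I y) + m    ≡⟨ cong (_+ m) (+-comm 1 (rank I y)) ⟩
      rank I y + 1 + m      ≡⟨ cong (λ w → rank w y + 1 + m) (sym back) ⟩
      rank (exchange v i 0) y + 1 + m ≡⟨ cong (_+ m) (W.rank-wrap y 0<y (≤-pred (≤-trans y<n (≤-reflexive (sym si≡n))))) ⟩
      rank v y + m          ∎
    bound′ : ∀ y → y < n → rank J y ≤ rank v y + m
    bound′ zero      _   = z≤n
    bound′ y@(suc _) y<n = ≤-trans (bound y y<n) (≤-reflexive (rank-I y z<s y<n))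
    attained′ : ∀ y → y < n → rank J y ≡ rank I y + suc m → ∃ λ y → y < n × rank J y ≡ rank v y + m
    attained′ zero      _   ()
    attained′ y@(suc _) y<n eq = y , y<n , trans eq (rank-I y z<s y<n)

  predecessor : ∀ {m} → IsExcess J I m → PredecessorSite m → Predecessor m
  predecessor e (shift-site i si<n i∈I si∉I slack) = shift-predecessor e i si<n i∈I si∉I slack
  predecessor e (wrap-site i si≡n i∈I 0∉I 0<m)     = wrap-predecessor e i si≡n i∈I 0∉I 0<m

module Distance {n} (J : Subset n) {k} (|J| : rank J n ≡ k) (k<n : k < n) where

  private
    0<n : 0 < n
    0<n = ≤-<-trans z≤n k<n

    ∑-rank-+ : ∀ (I : Subset n) m → ∑ n (λ x → rank I x + m) ≡ m * n + rankSum I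
    ∑-rank-+ I m = trans (∑-distrib-+ n (rank I) (λ _ → m))
                     (trans (+-comm (rankSum I) _) (cong (_+ rankSum I) (trans (∑-const n m) (*-comm n m))))

  reach-of-potential : ∀ t {I m} → rank I n ≡ k → IsExcess J I m → m * n + rankSum I ≡ rankSum J + t →
                       Reach n t J I
  reach-of-potential zero {I} {m} |I| (bound , _) pot = subst (Reach n 0 J) J≡I done
    where
    tight : ∀ x → x < n → rank J x ≡ rank I x + m
    tight = ∑-mono-≤-rigid n bound (sym (trans (∑-rank-+ I m) (trans pot (+-identityʳ _))))
    J≡I : J ≡ I
    J≡I = rank-injective λ x x≤n → case x≤n
      where
      case : ∀ {x} → x ≤ n → rank J x ≡ rank I x
      case {x} x≤n with m≤n⇒m<n∨m≡n x≤n
      ... | inj₁ x<n  = trans (tight x x<n) (trans (cong (rank I x +_) (sym (tight 0 0<n))) (+-identityʳ _))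
      ... | inj₂ refl = trans |J| (sym |I|)
  reach-of-potential (suc t) {I} {m} |I| e pot =
    reach-snoc (reach-of-potential t (trans size |I|) isExcess pot′) (move⇒step move)
    where
    open Predecessors J I
    J<pot : rankSum J < m * n + rankSum I
    J<pot = subst (rankSum J <_) (sym pot) (m<m+n (rankSum J) z<s)
    open Predecessor (predecessor e (site-exists |J| |I| k<n e J<pot))
    pot′ : excess * n + rankSum source ≡ rankSum J + t
    pot′ = +-cancelʳ-≡ 1 _ _ (trans potential (trans pot (trans (+-suc (rankSum J) t) (+-comm 1 _))))

  distance-formula : ∀ {I m d} → rank I n ≡ k → IsExcess J I m → IsDist n J I d → d + rankSum J ≡ m * n + rankSum I
  distance-formula {I} {m} {d} |I| e (path , minimal) = ≤-antisym upper lower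
    where
    J≤pot : rankSum J ≤ m * n + rankSum I
    J≤pot = ≤-trans (∑-mono-≤ n (proj₁ e)) (≤-reflexive (∑-rank-+ I m))
    pot : m * n + rankSum I ≡ rankSum J + (m * n + rankSum I ∸ rankSum J)
    pot = sym (m+[n∸m]≡n J≤pot)
    upper : d + rankSum J ≤ m * n + rankSum I
    upper = ≤-trans (+-monoˡ-≤ (rankSum J) (minimal _ (reach-of-potential _ |I| e pot)))
                    (≤-reflexive (trans (+-comm _ (rankSum J)) (sym pot)))
    lower : m * n + rankSum I ≤ d + rankSum J
    lower = ≤-trans (excess-≤-reach e path) (≤-reflexive (+-comm (rankSum J) d))

-- Defaults to n when no x < n has m ≤ f x.
first : ℕ → (ℕ → ℕ) → ℕ → ℕ
first zero    f m = 0
first (suc n) f m with m ≤? f 0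
... | yes _ = 0
... | no  _ = suc (first n (f ∘ suc) m)

first-≤ : ∀ n f m → first n f m ≤ n
first-≤ zero    f m = z≤n
first-≤ (suc n) f m with m ≤? f 0
... | yes _ = z≤n
... | no  _ = s≤s (first-≤ n (f ∘ suc) m)

first-minimal : ∀ n f m x → x < first n f m → f x < m
first-minimal (suc n) f m x x<first with m ≤? f 0
first-minimal (suc n) f m zero    _             | no m≰f0 = ≰⇒> m≰f0
first-minimal (suc n) f m (suc x) (s<s x<first) | no _    = first-minimal n (f ∘ suc) m x x<first

first-reached : ∀ n f m → first n f m < n → m ≤ f (first n f m)
first-reached (suc n) f m lt with m ≤? f 0
... | yes m≤f0 = m≤f0
... | no  _    = first-reached n (f ∘ suc) m (≤-pred lt)

first≤⇔reached : ∀ n f → (∀ {x y} → x ≤ y → f x ≤ f y) → ∀ m x → x < n →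
                 (first n f m ≤ x → m ≤ f x) × (m ≤ f x → first n f m ≤ x)
first≤⇔reached n f f-mono m x x<n = reached , bounded
  where
  reached : first n f m ≤ x → m ≤ f x
  reached first≤x = ≤-trans (first-reached n f m (≤-<-trans first≤x x<n)) (f-mono first≤x)
  bounded : m ≤ f x → first n f m ≤ x
  bounded m≤fx = ≮⇒≥ (λ x<first → <⇒≱ (first-minimal n f m x x<first) m≤fx)

module _ (d′ : ℕ) (g : ℕ → ℕ) where

  private
    d = suc d′

  -- The sum of g over the cyclic interval a + 1, …, b of ℤ/d (all of ℤ/d when a = b).
  ∑-cyclic : ℕ → ℕ → ℕ
  ∑-cyclic a b = ∑ (suc ((b + d ∸ suc a) % d)) (λ q → g ((a + suc q) % d))

  ∑-cyclic-< : ∀ {a b} → a < b → b < d → ∑-cyclic a b + ∑ (suc a) g ≡ ∑ (suc b) g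
  ∑-cyclic-< {a} {b} a<b b<d = begin
      ∑-cyclic a b + ∑ (suc a) g                          ≡⟨ cong (_+ ∑ (suc a) g) interval ⟩
      ∑ (b ∸ a) (λ q → g (suc a + q)) + ∑ (suc a) g       ≡⟨ +-comm _ (∑ (suc a) g) ⟩
      ∑ (suc a) g + ∑ (b ∸ a) (λ q → g (suc a + q))       ≡⟨ ∑-split (suc a) (b ∸ a) g ⟨
      ∑ (suc a + (b ∸ a)) g                               ≡⟨ cong (λ l → ∑ (suc l) g) (m+[n∸m]≡n (<⇒≤ a<b)) ⟩
      ∑ (suc b) g                                         ∎
    where
    open ≡-Reasoning
    length : suc ((b + d ∸ suc a) % d) ≡ b ∸ a
    length = begin
      suc ((b + d ∸ suc a) % d)         ≡⟨ cong (λ l → suc (l % d)) (+-∸-comm d a<b) ⟩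
      suc ((b ∸ suc a + d) % d)         ≡⟨ cong suc ([m+n]%n≡m%n (b ∸ suc a) d) ⟩
      suc ((b ∸ suc a) % d)             ≡⟨ cong suc (m<n⇒m%n≡m (≤-<-trans (m∸n≤m b (suc a)) b<d)) ⟩
      suc (b ∸ suc a)                   ≡⟨ +-∸-assoc 1 a<b ⟨
      b ∸ a                             ∎
    interval : ∑-cyclic a b ≡ ∑ (b ∸ a) (λ q → g (suc a + q))
    interval = trans (cong (λ l → ∑ l (λ q → g ((a + suc q) % d))) length)
      (∑-cong (b ∸ a) (λ q q<b-a → cong g (trans (m<n⇒m%n≡m (≤-trans (s≤s (≤-trans (+-monoʳ-≤ a q<b-a)
        (≤-reflexive (m+[n∸m]≡n (<⇒≤ a<b))))) b<d)) (+-suc a q))))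

  ∑-cyclic-≥ : ∀ {a b} → b ≤ a → a < d → ∑-cyclic a b + ∑ (suc a) g ≡ ∑ (suc b) g + ∑ d g
  ∑-cyclic-≥ {a} {b} b≤a a<d = begin
      ∑-cyclic a b + ∑ (suc a) g
        ≡⟨ cong (λ l → ∑ l (λ q → g ((a + suc q) % d)) + ∑ (suc a) g) length ⟩
      ∑ (r + suc b) (λ q → g ((a + suc q) % d)) + ∑ (suc a) g
        ≡⟨ cong (_+ ∑ (suc a) g) (∑-split r (suc b) _) ⟩
      ∑ r (λ q → g ((a + suc q) % d)) + ∑ (suc b) (λ q → g ((a + suc (r + q)) % d)) + ∑ (suc a) g
        ≡⟨ cong₂ (λ x y → x + y + ∑ (suc a) g) tail wrapped ⟩
      ∑ r (λ q → g (suc a + q)) + ∑ (suc b) g + ∑ (suc a) g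
        ≡⟨ solve 3 (λ x y z → x :+ y :+ z := y :+ (z :+ x)) refl (∑ r (λ q → g (suc a + q))) (∑ (suc b) g) (∑ (suc a) g) ⟩
      ∑ (suc b) g + (∑ (suc a) g + ∑ r (λ q → g (suc a + q)))
        ≡⟨ cong (∑ (suc b) g +_) (∑-split (suc a) r g) ⟨
      ∑ (suc b) g + ∑ (suc a + r) g
        ≡⟨ cong (λ l → ∑ (suc b) g + ∑ l g) (m+[n∸m]≡n a<d) ⟩
      ∑ (suc b) g + ∑ d g
        ∎
    where
    open ≡-Reasoning
    r = d ∸ suc a
    length : suc ((b + d ∸ suc a) % d) ≡ r + suc b
    length = begin
      suc ((b + d ∸ suc a) % d)     ≡⟨ cong (λ l → suc (l % d)) (+-∸-assoc b a<d) ⟩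
      suc ((b + r) % d)             ≡⟨ cong suc (m<n⇒m%n≡m (≤-trans (+-monoˡ-≤ r (s≤s b≤a)) (≤-reflexive (m+[n∸m]≡n a<d)))) ⟩
      suc (b + r)                   ≡⟨ cong suc (+-comm b r) ⟩
      suc (r + b)                   ≡⟨ +-suc r b ⟨
      r + suc b                     ∎
    tail : ∑ r (λ q → g ((a + suc q) % d)) ≡ ∑ r (λ q → g (suc a + q))
    tail = ∑-cong r (λ q q<r → cong g (trans (m<n⇒m%n≡m (≤-trans (+-monoʳ-≤ (suc a) q<r)
             (≤-reflexive (m+[n∸m]≡n a<d)))) (+-suc a q)))
    wrapped : ∑ (suc b) (λ q → g ((a + suc (r + q)) % d)) ≡ ∑ (suc b) g
    wrapped = ∑-cong (suc b) (λ q q≤b → cong g (trans (cong (_% d) (around q)) (trans ([m+n]%n≡m%n q d)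
                (m<n⇒m%n≡m (≤-<-trans (≤-pred q≤b) (≤-<-trans b≤a a<d))))))
      where
      around : ∀ q → a + suc (r + q) ≡ q + d
      around q = trans (+-suc a (r + q)) (trans (cong suc (sym (+-assoc a r q)))
                   (trans (cong (_+ q) (m+[n∸m]≡n a<d)) (+-comm d q)))

  ∑-cyclic-prefix : ∀ a b → a < d → b < d → ∑-cyclic a b + ∑ (suc a) g ≡ ∑ (suc b) g + ∑ d g * ind (b <ᵇ suc a)
  ∑-cyclic-prefix a b a<d b<d with a <? b
  ... | yes a<b = trans (∑-cyclic-< a<b b<d)
          (sym (trans (cong (∑ (suc b) g +_) (trans (cong (∑ d g *_) (ind-<ᵇ-≥ a<b)) (*-zeroʳ (∑ d g)))) (+-identityʳ _)))
  ... | no  a≮b = trans (∑-cyclic-≥ (≮⇒≥ a≮b) a<d)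
          (cong (∑ (suc b) g +_) (sym (trans (cong (∑ d g *_) (ind-<ᵇ-< (s≤s (≮⇒≥ a≮b)))) (*-identityʳ _))))

∑-pred : ∀ n f → 0 < n → ∑ n f ≡ f 0 + ∑ (pred n) (f ∘ suc)
∑-pred (suc n) f _ = refl

module Blocks {n} (J : Subset n) where

  β : ℕ → ℕ
  β x = ∑ x (λ y → ind (isStart J (suc y)))

  d : ℕ
  d = ∑ n (ind ∘ isStart J)

  numBlocks≡d : numBlocks J ≡ d
  numBlocks≡d = sumℕ≡∑ n _

  blk≡β%d : ∀ x → blk J x ≡ modn (β x) d
  blk≡β%d x = cong₂ modn (sumℕ≡∑ x _) numBlocks≡d

  β-mono : ∀ {x y} → x ≤ y → β x ≤ β y
  β-mono = ∑-≤-prefix _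

  β-suc : ∀ x → β (suc x) ≡ β x + ind (isStart J (suc x))
  β-suc x = ∑-suc x _

  d≡start₀+β : 0 < n → d ≡ ind (isStart J 0) + β (pred n)
  d≡start₀+β = ∑-pred n (ind ∘ isStart J)

  β≤d : ∀ x → x < n → β x ≤ d
  β≤d x x<n = begin
    β x                                ≤⟨ β-mono (<⇒≤pred x<n) ⟩
    β (pred n)                         ≤⟨ m≤n+m _ _ ⟩
    ind (isStart J 0) + β (pred n)     ≡⟨ d≡start₀+β (≤-<-trans z≤n x<n) ⟨
    d                                  ∎
    where open ≤-Reasoning

  -- π m is the m-th block start after position 0, or n if there are fewer than m of them.
  π : ℕ → ℕ
  π = first n β

  π≤n : ∀ m → π m ≤ n
  π≤n = first-≤ n β

  π≤⇔ : ∀ m x → x < n → (π m ≤ x → m ≤ β x) × (m ≤ β x → π m ≤ x)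
  π≤⇔ = first≤⇔reached n β β-mono

  ind-β<ᵇ : ∀ m x → x < n → ind (β x <ᵇ m) ≡ ind (x <ᵇ π m)
  ind-β<ᵇ m x x<n with β x <? m
  ... | yes βx<m = trans (ind-<ᵇ-< βx<m) (sym (ind-<ᵇ-< (≰⇒> (λ π≤x → <⇒≱ βx<m (proj₁ (π≤⇔ m x x<n) π≤x)))))
  ... | no  βx≮m = trans (ind-<ᵇ-≥ (≮⇒≥ βx≮m)) (sym (ind-<ᵇ-≥ (proj₂ (π≤⇔ m x x<n) (≮⇒≥ βx≮m))))

  runLenSum : ℕ → ℕ
  runLenSum m = ∑ m (runLen J)

  countInFirstBlocks : Subset n → ℕ → ℕ
  countInFirstBlocks v m = ∑∈ v (λ x → ind (blk J x <ᵇ m))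

  runLenSum≡count : ∀ m → runLenSum m ≡ countInFirstBlocks J m
  runLenSum≡count m = trans (∑-cong m (λ b _ → runLen≡ b)) (∑-fibres m n (ind ∘ at J) (blk J))
    where
    runLen≡ : ∀ b → runLen J b ≡ ∑ n (λ x → ind (at J x) * ind (blk J x ≡ᵇ b))
    runLen≡ b = trans (sumℕ≡∑ n _) (∑-cong n (λ x _ → ind-∧ (at J x) _))

  module Nonempty {d′} (d≡ : d ≡ suc d′) where

    blk-below : ∀ x → β x < d → blk J x ≡ β x
    blk-below x βx<d = trans (blk≡β%d x) (trans (cong (modn (β x)) d≡) (m<n⇒m%n≡m (≤-trans βx<d (≤-reflexive d≡))))

    blk-last : ∀ x → β x ≡ d → blk J x ≡ 0
    blk-last x βx≡d = trans (blk≡β%d x) (trans (cong₂ modn (trans βx≡d d≡) d≡) (n%n≡0 (suc d′)))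

    blk<d : ∀ x → x < n → blk J x < d
    blk<d x x<n with m≤n⇒m<n∨m≡n (β≤d x x<n)
    ... | inj₁ βx<d = subst (_< d) (sym (blk-below x βx<d)) βx<d
    ... | inj₂ βx≡d = subst (_< d) (sym (blk-last x βx≡d)) (subst (0 <_) (sym d≡) z<s)

    -- Positions from π d on lie in the wrap-around block 0; before it, blk J x = β x.
    ind-blk<ᵇ : ∀ m x → x < n → 0 < m → m ≤ d → ind (blk J x <ᵇ m) + ind (x <ᵇ π d) ≡ ind (x <ᵇ π m) + 1
    ind-blk<ᵇ m x x<n 0<m m≤d with m≤n⇒m<n∨m≡n (β≤d x x<n)
    ... | inj₁ βx<d = begin
      ind (blk J x <ᵇ m) + ind (x <ᵇ π d)    ≡⟨ cong₂ (λ b c → ind (b <ᵇ m) + c) (blk-below x βx<d) (sym (ind-β<ᵇ d x x<n)) ⟩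
      ind (β x <ᵇ m) + ind (β x <ᵇ d)        ≡⟨ cong₂ _+_ (ind-β<ᵇ m x x<n) (ind-<ᵇ-< βx<d) ⟩
      ind (x <ᵇ π m) + 1                     ∎
      where open ≡-Reasoning
    ... | inj₂ βx≡d = begin
      ind (blk J x <ᵇ m) + ind (x <ᵇ π d)    ≡⟨ cong₂ (λ b c → ind (b <ᵇ m) + c) (blk-last x βx≡d) (sym (ind-β<ᵇ d x x<n)) ⟩
      ind (0 <ᵇ m) + ind (β x <ᵇ d)          ≡⟨ cong₂ _+_ (ind-<ᵇ-< 0<m) (ind-<ᵇ-≥ (≤-reflexive (sym βx≡d))) ⟩
      1                                      ≡⟨ cong (_+ 1) (trans (sym (ind-<ᵇ-≥ (≤-trans m≤d (≤-reflexive (sym βx≡d))))) (ind-β<ᵇ m x x<n)) ⟩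
      ind (x <ᵇ π m) + 1                     ∎
      where open ≡-Reasoning

    count-π : ∀ v m → 0 < m → m ≤ d → countInFirstBlocks v m + rank v (π d) ≡ rank v (π m) + rank v n
    count-π v m 0<m m≤d = begin
      countInFirstBlocks v m + rank v (π d)                         ≡⟨ cong (countInFirstBlocks v m +_) (∑∈-<ᵇ v (π d) (π≤n d)) ⟨
      countInFirstBlocks v m + ∑∈ v (λ x → ind (x <ᵇ π d))         ≡⟨ ∑∈-distrib-+ v _ _ ⟨
      ∑∈ v (λ x → ind (blk J x <ᵇ m) + ind (x <ᵇ π d))             ≡⟨ ∑∈-cong v (λ x x<n → ind-blk<ᵇ m x x<n 0<m m≤d) ⟩
      ∑∈ v (λ x → ind (x <ᵇ π m) + 1)                              ≡⟨ ∑∈-distrib-+ v _ _ ⟩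
      ∑∈ v (λ x → ind (x <ᵇ π m)) + ∑∈ v (λ _ → 1)                 ≡⟨ cong₂ _+_ (∑∈-<ᵇ v (π m) (π≤n m)) (trans (∑∈-const v 1) (*-identityʳ _)) ⟩
      rank v (π m) + rank v n                                      ∎
      where open ≡-Reasoning

    runLenSum-d : runLenSum d ≡ rank J n
    runLenSum-d = +-cancelʳ-≡ (rank J (π d)) _ _ (trans (cong (_+ rank J (π d)) (runLenSum≡count d))
                    (trans (count-π J d (subst (0 <_) (sym d≡) z<s) ≤-refl) (+-comm _ (rank J n))))

isStart-suc : ∀ {n} (J : Subset n) {z} → at J (suc z) ≡ false → at J z ≡ true → isStart J (suc z) ≡ true
isStart-suc J sz∉J z∈J rewrite sz∉J | z∈J = refl

isStart-0 : ∀ {n} (J : Subset n) → at J 0 ≡ false → at J (n ∸ 1) ≡ true → isStart J 0 ≡ true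
isStart-0 {zero}  [] _   ()
isStart-0 {suc n} J 0∉J last∈J rewrite 0∉J | last∈J = refl

-- rank J - rank I cannot drop along a run of J (read forwards) or a gap of J (read backwards),
-- so a position where rank J ≥ rank I + c can be pushed to a block start.
module BlockStarts {n} (J I : Subset n) where

  Tight : ℕ → ℕ → Set
  Tight c y = rank I y + c ≤ rank J y

  along-run : ∀ c f y → y + f ≡ n → Tight c y →
              ∃ λ z → y ≤ z × Tight c z × (∀ w → y ≤ w → w < z → at J w ≡ true) × (z ≡ n ⊎ (z < n × at J z ≡ false))
  along-run c zero y y≡n tight =
    y , ≤-refl , tight , (λ w y≤w w<y → ⊥-elim (<⇒≱ w<y y≤w)) , inj₁ (trans (sym (+-identityʳ y)) y≡n)
  along-run c (suc f) y y+f≡n tight with at J y in y∈J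
  ... | false = y , ≤-refl , tight , (λ w y≤w w<y → ⊥-elim (<⇒≱ w<y y≤w)) ,
                inj₂ (≤-trans (s≤s (m≤m+n y f)) (≤-reflexive (trans (sym (+-suc y f)) y+f≡n)) , y∈J)
  ... | true with along-run c f (suc y) (trans (sym (+-suc y f)) y+f≡n) tight-sy
    where
    tight-sy : Tight c (suc y)
    tight-sy = begin
      rank I (suc y) + c         ≤⟨ +-monoˡ-≤ c (rank-suc-≤ I y) ⟩
      rank I y + 1 + c           ≡⟨ solve 2 (λ r c → r :+ con 1 :+ c := r :+ c :+ con 1) refl (rank I y) c ⟩
      rank I y + c + 1           ≤⟨ +-monoˡ-≤ 1 tight ⟩
      rank J y + 1               ≡⟨ cong (λ t → rank J y + ind t) y∈J ⟨
      rank J y + ind (at J y)    ≡⟨ rank-suc J y ⟨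
      rank J (suc y)             ∎
      where open ≤-Reasoning
  ...   | z , sy≤z , tight-z , run , end = z , ≤-trans (n≤1+n y) sy≤z , tight-z , run′ , end
    where
    run′ : ∀ w → y ≤ w → w < z → at J w ≡ true
    run′ w y≤w w<z with m≤n⇒m<n∨m≡n y≤w
    ... | inj₁ y<w  = run w y<w w<z
    ... | inj₂ refl = y∈J

  along-gap : ∀ c y → Tight c y →
              ∃ λ z → z ≤ y × Tight c z × (∀ w → z ≤ w → w < y → at J w ≡ false) × (z ≡ 0 ⊎ ∃ λ z′ → z ≡ suc z′ × at J z′ ≡ true)
  along-gap c zero tight = 0 , z≤n , tight , (λ w _ w<0 → ⊥-elim (<⇒≱ w<0 z≤n)) , inj₁ refl
  along-gap c (suc y) tight with at J y in y∈J
  ... | true  = suc y , ≤-refl , tight , (λ w sy≤w w<sy → ⊥-elim (<⇒≱ w<sy sy≤w)) , inj₂ (y , refl , y∈J)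
  ... | false with along-gap c y tight-y
    where
    tight-y : Tight c y
    tight-y = begin
      rank I y + c               ≤⟨ +-monoˡ-≤ c (rank-mono I (n≤1+n y)) ⟩
      rank I (suc y) + c         ≤⟨ tight ⟩
      rank J (suc y)             ≡⟨ rank-suc J y ⟩
      rank J y + ind (at J y)    ≡⟨ cong (λ t → rank J y + ind t) y∈J ⟩
      rank J y + 0               ≡⟨ +-identityʳ _ ⟩
      rank J y                   ∎
      where open ≤-Reasoning
  ...   | z , z≤y , tight-z , gap , end = z , ≤-trans z≤y (n≤1+n y) , tight-z , gap′ , end
    where
    gap′ : ∀ w → z ≤ w → w < suc y → at J w ≡ false
    gap′ w z≤w w<sy with m≤n⇒m<n∨m≡n (≤-pred w<sy)
    ... | inj₁ w<y  = gap w z≤w w<y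
    ... | inj₂ refl = y∈J

  module _ {k} (|J| : rank J n ≡ k) (|I| : rank I n ≡ k) (0<k : 0 < k) (k<n : k < n) where

    TightStart : ℕ → Set
    TightStart c = ∃ λ s → s < n × isStart J s ≡ true × Tight c s

    private
      0<n : 0 < n
      0<n = <-trans 0<k k<n

      true≢false : ∀ {b} → b ≡ true → b ≡ false → ∀ {A : Set} → A
      true≢false refl ()

    tight-start₀ : TightStart 0
    tight-start₀ with at J 0 in 0∈J
    ... | true with along-run 0 n 0 refl z≤n
    ...   | _ , _ , _ , run , inj₁ refl =
            ⊥-elim (<-irrefl (trans (sym |J|) (rank-full J (λ z z<n → run z z≤n z<n) n ≤-refl)) k<n)
    ...   | zero  , _ , _ , _ , inj₂ (_ , 0∉J)            = true≢false 0∈J 0∉J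
    ...   | suc w , _ , tight , run , inj₂ (w<n , sw∉J) = suc w , w<n , isStart-suc J sw∉J (run w z≤n (n<1+n w)) , tight
    tight-start₀ | false with at J (n ∸ 1) in last∈J
    ...   | true  = 0 , 0<n , isStart-0 J 0∈J last∈J , z≤n
    ...   | false with along-gap 0 n (≤-reflexive (trans (+-identityʳ _) (trans |I| (sym |J|))))
    ...     | zero  , _ , _ , gap , _ =
              ⊥-elim (<-irrefl (sym (trans (sym |J|) (rank-empty J n (λ z z<n → gap z z≤n z<n)))) 0<k)
    ...     | suc z , _ , _ , _ , inj₁ ()
    ...     | suc z , sz≤n , tight , gap , inj₂ (.z , refl , z∈J) with m≤n⇒m<n∨m≡n sz≤n
    ...       | inj₁ sz<n = suc z , sz<n , isStart-suc J (gap (suc z) ≤-refl sz<n) z∈J , tight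
    ...       | inj₂ refl = true≢false z∈J last∈J

    tight-start : ∀ {c} y → y < n → Tight c y → TightStart c
    tight-start {c} y y<n tight with along-gap c y tight
    ... | zero  , _ , tight₀ , _ , _ = subst TightStart (sym (n≤0⇒n≡0 tight₀)) tight-start₀
    ... | suc z , _ , _ , _ , inj₁ ()
    ... | suc z , sz≤y , tight-sz , _ , inj₂ (.z , refl , z∈J) with at J (suc z) in sz∈J
    ...   | false = suc z , ≤-<-trans sz≤y y<n , isStart-suc J sz∈J z∈J , tight-sz
    ...   | true with along-run c (n ∸ suc z) (suc z) (m+[n∸m]≡n (<⇒≤ (≤-<-trans sz≤y y<n))) tight-sz
    ...     | _ , _ , tight-n , _ , inj₁ refl = subst TightStart (sym c≡0) tight-start₀
      where
      c≡0 : c ≡ 0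
      c≡0 = n≤0⇒n≡0 (+-cancelˡ-≤ k _ _ (≤-trans (≤-reflexive (cong (_+ c) (sym |I|))) (≤-trans tight-n (≤-reflexive (trans |J| (sym (+-identityʳ k)))))))
    ...     | suc w , sz≤sw , tight-w , run , inj₂ (sw<n , sw∉J) =
              suc w , sw<n , isStart-suc J sw∉J (run w sz≤w (n<1+n w)) , tight-w
      where
      sz≤w : suc z ≤ w
      sz≤w with m≤n⇒m<n∨m≡n sz≤sw
      ... | inj₁ sz<sw = ≤-pred sz<sw
      ... | inj₂ refl  = true≢false sz∈J sw∉J

    excess-at-start : ∀ {m} → IsExcess J I m → ∃ λ s → s < n × isStart J s ≡ true × rank J s ≡ rank I s + m
    excess-at-start (bound , x , x<n , attained) with tight-start x x<n (≤-reflexive (sym attained))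
    ... | s , s<n , start , tight = s , s<n , start , ≤-antisym (bound s s<n) tight

min< : ℕ → (ℕ → ℕ) → ℕ → ℕ
min< z f zero    = z
min< z f (suc d) = f 0 ⊓ min< z (f ∘ suc) d

foldr-⊓≡min< : ∀ z f d → foldr _⊓_ z (map f (upTo d)) ≡ min< z f d
foldr-⊓≡min< z f d = trans (cong (foldr _⊓_ z) (map-applyUpTo (λ x → x) f d)) (unfold f d)
  where
  unfold : ∀ f d → foldr _⊓_ z (applyUpTo f d) ≡ min< z f d
  unfold f zero    = refl
  unfold f (suc d) = cong (f 0 ⊓_) (unfold (f ∘ suc) d)

min<-lb : ∀ z f d a → a < d → min< z f d ≤ f a
min<-lb z f (suc d) zero    _         = m⊓n≤m _ _
min<-lb z f (suc d) (suc a) (s<s a<d) = ≤-trans (m⊓n≤n _ _) (min<-lb z (f ∘ suc) d a a<d)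

min<-attained : ∀ z f d → min< z f d ≡ z ⊎ ∃ λ a → a < d × min< z f d ≡ f a
min<-attained z f zero    = inj₁ refl
min<-attained z f (suc d) with ≤-total (f 0) (min< z (f ∘ suc) d)
... | inj₁ f0≤rest = inj₂ (0 , z<s , m≤n⇒m⊓n≡m f0≤rest)
... | inj₂ rest≤f0 with min<-attained z (f ∘ suc) d
...   | inj₁ rest≡z            = inj₁ (trans (m≥n⇒m⊓n≡n rest≤f0) rest≡z)
...   | inj₂ (a , a<d , rest≡) = inj₂ (suc a , s<s a<d , trans (m≥n⇒m⊓n≡n rest≤f0) rest≡)

min<-char : ∀ f d c e → 0 < d → (∀ a → a < d → c ≤ f a + e) → (∃ λ a → a < d × c ≡ f a + e) →
            c ≡ min< (f 0) f d + e
min<-char f d c e 0<d lb (a , a<d , c≡) =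
  ≤-antisym upper (≤-trans (+-monoˡ-≤ e (min<-lb (f 0) f d a a<d)) (≤-reflexive (sym c≡)))
  where
  upper : c ≤ min< (f 0) f d + e
  upper with min<-attained (f 0) f d
  ... | inj₁ min≡f0           = ≤-trans (lb 0 0<d) (≤-reflexive (cong (_+ e) (sym min≡f0)))
  ... | inj₂ (b , b<d , min≡) = ≤-trans (lb b b<d) (≤-reflexive (cong (_+ e) (sym min≡)))

module Roof {n} (J : Subset n) {k} (|J| : rank J n ≡ k) (0<k : 0 < k) (k<n : k < n) where

  open Blocks J

  0<d : 0 < d
  0<d with BlockStarts.tight-start₀ J J |J| |J| 0<k k<n
  ... | s , s<n , start , _ = subst (_≤ d) (cong ind start) (f≤∑ n (ind ∘ isStart J) s s<n)

  d′ : ℕ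
  d′ = pred d

  d≡ : d ≡ suc d′
  d≡ = sym (suc-pred d {{>-nonZero 0<d}})

  open Nonempty d≡

  wCoeff≡∑-cyclic : ∀ a x → wCoeff J a x ≡ ∑-cyclic d′ (runLen J) a (blk J x)
  wCoeff≡∑-cyclic a x = trans (cong coefficient (trans numBlocks≡d d≡))
    (sumℕ≡∑ (suc ((blk J x + suc d′ ∸ suc a) % suc d′)) (λ q → runLen J ((a + suc q) % suc d′)))
    where
    coefficient : ℕ → ℕ
    coefficient d = sumℕ (suc (modn (blk J x + d ∸ suc a) d)) (λ q → runLen J (modn (a + suc q) d))

  wCoeff-cyclic : ∀ a x → a < d → x < n →
                  wCoeff J a x + runLenSum (suc a) ≡ runLenSum (suc (blk J x)) + k * ind (blk J x <ᵇ suc a)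
  wCoeff-cyclic a x a<d x<n = begin
      wCoeff J a x + runLenSum (suc a)
        ≡⟨ cong (_+ runLenSum (suc a)) (wCoeff≡∑-cyclic a x) ⟩
      ∑-cyclic d′ (runLen J) a (blk J x) + runLenSum (suc a)
        ≡⟨ ∑-cyclic-prefix d′ (runLen J) a (blk J x) (subst (a <_) d≡ a<d) (subst (blk J x <_) d≡ (blk<d x x<n)) ⟩
      runLenSum (suc (blk J x)) + ∑ (suc d′) (runLen J) * ind (blk J x <ᵇ suc a)
        ≡⟨ cong (λ t → runLenSum (suc (blk J x)) + t * ind (blk J x <ᵇ suc a)) total ⟩
      runLenSum (suc (blk J x)) + k * ind (blk J x <ᵇ suc a)
        ∎
    where
    open ≡-Reasoning
    total : ∑ (suc d′) (runLen J) ≡ k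
    total = trans (cong (λ l → ∑ l (runLen J)) (sym d≡)) (trans runLenSum-d |J|)

  A : Subset n → ℕ
  A I = ∑∈ I (λ x → runLenSum (suc (blk J x)))

  WdotI-count : ∀ a I → rank I n ≡ k → a < d →
                WdotI J a I + k * countInFirstBlocks J (suc a) ≡ A I + k * countInFirstBlocks I (suc a)
  WdotI-count a I |I| a<d = begin
      WdotI J a I + k * countInFirstBlocks J (suc a)
                    ≡⟨ cong₂ (λ w c → w + c * countInFirstBlocks J (suc a)) (sumℕ≡∑ n (λ x → ind (at I x) * wCoeff J a x)) (sym |I|) ⟩
      ∑∈ I (wCoeff J a) + rank I n * countInFirstBlocks J (suc a)
                    ≡⟨ cong (∑∈ I (wCoeff J a) +_) (trans (cong (rank I n *_) (sym (runLenSum≡count (suc a)))) (sym (∑∈-const I _))) ⟩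
      ∑∈ I (wCoeff J a) + ∑∈ I (λ _ → runLenSum (suc a))
                    ≡⟨ ∑∈-distrib-+ I _ _ ⟨
      ∑∈ I (λ x → wCoeff J a x + runLenSum (suc a))
                    ≡⟨ ∑∈-cong I (λ x x<n → wCoeff-cyclic a x a<d x<n) ⟩
      ∑∈ I (λ x → runLenSum (suc (blk J x)) + k * ind (blk J x <ᵇ suc a))
                    ≡⟨ ∑∈-distrib-+ I _ _ ⟩
      A I + ∑∈ I (λ x → k * ind (blk J x <ᵇ suc a))
                    ≡⟨ cong (A I +_) (∑∈-distribˡ-* I k _) ⟩
      A I + k * countInFirstBlocks I (suc a)
                    ∎
    where open ≡-Reasoning

  WdotI-formula : ∀ a I → rank I n ≡ k → a < d →
    WdotI J a I + k * rank J (π (suc a)) + k * rank I (π d) ≡ A I + k * rank J (π d) + k * rank I (π (suc a))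
  WdotI-formula a I |I| a<d = +-cancelʳ-≡ (k * k) _ _ (begin
      W + k * rJ′ + k * rI + k * k      ≡⟨ solve 4 (λ W k a b → W :+ k :* a :+ k :* b :+ k :* k := W :+ k :* (a :+ k) :+ k :* b) refl W k rJ′ rI ⟩
      W + k * (rJ′ + k) + k * rI        ≡⟨ cong (λ t → W + k * t + k * rI) (trans (count-π J (suc a) z<s a<d) (cong (rJ′ +_) |J|)) ⟨
      W + k * (cJ + rJ) + k * rI        ≡⟨ solve 5 (λ W k a b c → W :+ k :* (a :+ b) :+ k :* c := W :+ k :* a :+ k :* b :+ k :* c) refl W k cJ rJ rI ⟩
      W + k * cJ + k * rJ + k * rI      ≡⟨ cong (λ t → t + k * rJ + k * rI) (WdotI-count a I |I| a<d) ⟩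
      A I + k * cI + k * rJ + k * rI    ≡⟨ solve 5 (λ A k a b c → A :+ k :* a :+ k :* b :+ k :* c := A :+ k :* b :+ k :* (a :+ c)) refl (A I) k cI rJ rI ⟩
      A I + k * rJ + k * (cI + rI)      ≡⟨ cong (λ t → A I + k * rJ + k * t) (trans (count-π I (suc a) z<s a<d) (cong (rI′ +_) |I|)) ⟩
      A I + k * rJ + k * (rI′ + k)      ≡⟨ solve 5 (λ A k a b c → A :+ k :* a :+ k :* (b :+ c) := A :+ k :* a :+ k :* b :+ k :* c) refl (A I) k rJ rI′ k ⟩
      A I + k * rJ + k * rI′ + k * k    ∎)
    where
    open ≡-Reasoning
    W   = WdotI J a I
    cJ  = countInFirstBlocks J (suc a)
    cI  = countInFirstBlocks I (suc a)
    rJ  = rank J (π d)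
    rI  = rank I (π d)
    rJ′ = rank J (π (suc a))
    rI′ = rank I (π (suc a))

  π-d-start₀ : isStart J 0 ≡ true → π d ≡ n
  π-d-start₀ start₀ = ≤-antisym (π≤n d) (≮⇒≥ (λ π<n → <⇒≱ (β<d (π d) π<n) (proj₁ (π≤⇔ d (π d) π<n) ≤-refl)))
    where
    β<d : ∀ x → x < n → β x < d
    β<d x x<n = begin-strict
      β x                                ≤⟨ β-mono (<⇒≤pred x<n) ⟩
      β (pred n)                         <⟨ n<1+n _ ⟩
      1 + β (pred n)                     ≡⟨ cong (λ b → ind b + β (pred n)) start₀ ⟨
      ind (isStart J 0) + β (pred n)     ≡⟨ d≡start₀+β (≤-<-trans z≤n x<n) ⟨
      d                                  ∎
      where open ≤-Reasoning

  β-at-start : ∀ s → isStart J (suc s) ≡ true → β (suc s) ≡ suc (β s)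
  β-at-start s start = trans (β-suc s) (trans (cong (λ b → β s + ind b) start) (+-comm (β s) 1))

  π-after-start : ∀ s → isStart J (suc s) ≡ true → suc s < n → π (suc (β s)) ≡ suc s
  π-after-start s start ss<n = ≤-antisym (proj₂ (π≤⇔ _ (suc s) ss<n) (≤-reflexive (sym (β-at-start s start))))
    (≰⇒> (λ π≤s → <-irrefl refl (proj₁ (π≤⇔ _ s (<-trans (n<1+n s) ss<n)) π≤s)))

  module _ (I : Subset n) {m} (|I| : rank I n ≡ k) (excess : IsExcess J I m) where

    excess-bound-π : ∀ a → rank J (π (suc a)) ≤ rank I (π (suc a)) + m
    excess-bound-π a with π (suc a) <? n
    ... | yes π<n = proj₁ excess (π (suc a)) π<n
    ... | no  π≮n rewrite ≤-antisym (π≤n (suc a)) (≮⇒≥ π≮n) = ≤-trans (≤-reflexive (trans |J| (sym |I|))) (m≤m+n _ m)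

    -- The excess is attained at a block start s, which is π (suc a) for a suitable a.
    excess-attained-π : ∃ λ a → a < d × rank J (π (suc a)) ≡ rank I (π (suc a)) + m
    excess-attained-π with BlockStarts.excess-at-start J I |J| |I| 0<k k<n excess
    ... | zero , _ , start₀ , m≡0 = d′ , subst (d′ <_) (sym d≡) (n<1+n d′) ,
            subst (λ p → rank J p ≡ rank I p + m) (sym (trans (cong π (sym d≡)) (π-d-start₀ start₀)))
              (trans |J| (trans (sym |I|) (trans (sym (+-identityʳ _)) (cong (rank I n +_) m≡0))))
    ... | suc s , ss<n , start , eq = β s , ≤-trans (≤-reflexive (sym (β-at-start s start))) (β≤d (suc s) ss<n) ,
            subst (λ p → rank J p ≡ rank I p + m) (sym (π-after-start s start ss<n)) eq

    minW-formula : minW J I + k * m + k * rank I (π d) ≡ A I + k * rank J (π d)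
    minW-formula = sym (begin
        c                                  ≡⟨ min<-char W d c e 0<d lower attained ⟩
        min< (W 0) W d + e                 ≡⟨ cong (λ l → min< (W 0) W l + e) numBlocks≡d ⟨
        min< (W 0) W (numBlocks J) + e     ≡⟨ cong (_+ e) (foldr-⊓≡min< (W 0) W (numBlocks J)) ⟨
        minW J I + e                       ≡⟨ +-assoc (minW J I) _ _ ⟨
        minW J I + k * m + k * rank I (π d) ∎)
      where
      open ≡-Reasoning
      W : ℕ → ℕ
      W a = WdotI J a I
      c = A I + k * rank J (π d)
      e = k * m + k * rank I (π d)
      shifted : ∀ a → a < d → c + k * rank I (π (suc a)) ≡ W a + k * rank J (π (suc a)) + k * rank I (π d)
      shifted a a<d = sym (WdotI-formula a I |I| a<d)
      regroup : ∀ a → W a + k * (rank I (π (suc a)) + m) + k * rank I (π d) ≡ W a + e + k * rank I (π (suc a))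
      regroup a = solve 5 (λ w k r m s → w :+ k :* (r :+ m) :+ k :* s := w :+ (k :* m :+ k :* s) :+ k :* r)
                    refl (W a) k (rank I (π (suc a))) m (rank I (π d))
      lower : ∀ a → a < d → c ≤ W a + e
      lower a a<d = +-cancelʳ-≤ (k * rank I (π (suc a))) _ _
        (≤-trans (≤-reflexive (shifted a a<d))
          (≤-trans (+-monoˡ-≤ _ (+-monoʳ-≤ (W a) (*-monoʳ-≤ k (excess-bound-π a)))) (≤-reflexive (regroup a))))
      attained : ∃ λ a → a < d × c ≡ W a + e
      attained with excess-attained-π
      ... | a , a<d , eq = a , a<d , +-cancelʳ-≡ (k * rank I (π (suc a))) _ _
        (trans (shifted a a<d) (trans (cong (λ r → W a + k * r + k * rank I (π d)) eq) (regroup a)))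

module RationalCoordinates where

  open Simple (fromCommutativeRing ℚ.+-*-commutativeRing) ℚ._≟_
    using () renaming (solve to solveℚ; _:+_ to _⊕_; _:*_ to _⊛_; :-_ to ⊝_; _:=_ to _≐_)

  private
    toℚᵘ-fromℕ : ∀ a → toℚᵘ (fromℕ a) ≃ mkℚᵘ (ℤ.+ a) 0
    toℚᵘ-fromℕ a = ℚ.toℚᵘ-fromℚᵘ (mkℚᵘ (ℤ.+ a) 0)

  fromℕ-+ : ∀ a b → fromℕ (a + b) ≡ fromℕ a ℚ.+ fromℕ b
  fromℕ-+ a b = ℚ.toℚᵘ-injective (ℚᵘ.≃-trans (toℚᵘ-fromℕ (a + b))
    (ℚᵘ.≃-trans (*≡* (cong (ℤ._* ℤ.+ 1) (trans (ℤ.pos-+ a b) (sym (cong₂ ℤ._+_ (ℤ.*-identityʳ (ℤ.+ a)) (ℤ.*-identityʳ (ℤ.+ b)))))))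
      (ℚᵘ.≃-sym (ℚᵘ.≃-trans (ℚ.toℚᵘ-homo-+ (fromℕ a) (fromℕ b)) (ℚᵘ.+-cong (toℚᵘ-fromℕ a) (toℚᵘ-fromℕ b))))))

  fromℕ-* : ∀ a b → fromℕ (a * b) ≡ fromℕ a ℚ.* fromℕ b
  fromℕ-* a b = ℚ.toℚᵘ-injective (ℚᵘ.≃-trans (toℚᵘ-fromℕ (a * b))
    (ℚᵘ.≃-trans (*≡* (cong (ℤ._* ℤ.+ 1) (ℤ.pos-* a b)))
      (ℚᵘ.≃-sym (ℚᵘ.≃-trans (ℚ.toℚᵘ-homo-* (fromℕ a) (fromℕ b)) (ℚᵘ.*-cong (toℚᵘ-fromℕ a) (toℚᵘ-fromℕ b))))))

  inv-inverse : ∀ m → 0 < m → inv m ℚ.* fromℕ m ≡ 1ℚ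
  inv-inverse (suc m) _ = ℚ.toℚᵘ-injective (ℚᵘ.≃-trans (ℚ.toℚᵘ-homo-* (inv (suc m)) (fromℕ (suc m)))
    (ℚᵘ.≃-trans (ℚᵘ.*-cong (ℚ.toℚᵘ-fromℚᵘ (mkℚᵘ (ℤ.+ 1) m)) (toℚᵘ-fromℕ (suc m)))
      (*≡* (trans (ℤ.*-identityʳ _) (trans (ℤ.*-identityˡ _)
        (sym (trans (ℤ.*-identityˡ _) (cong ℤ.+_ (*-identityʳ (suc m))))))))))

  sumOver-scaled : ∀ {n} (I : Subset n) r (P Q : ℕ → ℕ) →
    sumOver I (λ x → r ℚ.* (fromℕ (P x) - fromℕ (Q x))) ≡ r ℚ.* (fromℕ (∑∈ I P) - fromℕ (∑∈ I Q))
  sumOver-scaled {n} I r P Q =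
    trans (cong (foldr ℚ._+_ 0ℚ) (map-applyUpTo (λ x → x) _ n)) (scaled-sum n _ _ _ pointwise)
    where
    pointwise : ∀ x → (if at I x then r ℚ.* (fromℕ (P x) - fromℕ (Q x)) else 0ℚ)
                      ≡ r ℚ.* (fromℕ (ind (at I x) * P x) - fromℕ (ind (at I x) * Q x))
    pointwise x with at I x
    ... | true  = cong₂ (λ p q → r ℚ.* (fromℕ p - fromℕ q)) (sym (+-identityʳ (P x))) (sym (+-identityʳ (Q x)))
    ... | false = sym (ℚ.*-zeroʳ r)
    scaled-sum : ∀ m (f : ℕ → ℚ) (P Q : ℕ → ℕ) → (∀ x → f x ≡ r ℚ.* (fromℕ (P x) - fromℕ (Q x))) →
                 foldr ℚ._+_ 0ℚ (applyUpTo f m) ≡ r ℚ.* (fromℕ (∑ m P) - fromℕ (∑ m Q))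
    scaled-sum zero    f P Q eq = sym (ℚ.*-zeroʳ r)
    scaled-sum (suc m) f P Q eq = begin
      f 0 ℚ.+ foldr ℚ._+_ 0ℚ (applyUpTo (f ∘ suc) m)
        ≡⟨ cong₂ ℚ._+_ (eq 0) (scaled-sum m (f ∘ suc) (P ∘ suc) (Q ∘ suc) (eq ∘ suc)) ⟩
      r ℚ.* (fromℕ (P 0) - fromℕ (Q 0)) ℚ.+ r ℚ.* (fromℕ (∑ m (P ∘ suc)) - fromℕ (∑ m (Q ∘ suc)))
        ≡⟨ solveℚ 5 (λ r a b c d → r ⊛ (a ⊕ ⊝ b) ⊕ r ⊛ (c ⊕ ⊝ d) ≐ r ⊛ ((a ⊕ c) ⊕ ⊝ (b ⊕ d)))
             refl r (fromℕ (P 0)) (fromℕ (Q 0)) (fromℕ (∑ m (P ∘ suc))) (fromℕ (∑ m (Q ∘ suc))) ⟩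
      r ℚ.* ((fromℕ (P 0) ℚ.+ fromℕ (∑ m (P ∘ suc))) - (fromℕ (Q 0) ℚ.+ fromℕ (∑ m (Q ∘ suc))))
        ≡⟨ cong₂ (λ p q → r ℚ.* (p - q)) (fromℕ-+ (P 0) _) (fromℕ-+ (Q 0) _) ⟨
      r ℚ.* (fromℕ (∑ (suc m) P) - fromℕ (∑ (suc m) Q))
        ∎
      where open ≡-Reasoning

  scaled-difference : ∀ n k w D p q → 0 < n → 0 < k → q ≡ n * w + k * D + p →
    ℚ.- (inv k ℚ.* fromℕ w) - inv n ℚ.* fromℕ D ≡ (inv n ℚ.* inv k) ℚ.* (fromℕ p - fromℕ q)
  scaled-difference n k w D p q 0<n 0<k q≡ = sym (begin
      (iN ℚ.* iK) ℚ.* (fromℕ p - fromℕ q)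
        ≡⟨ cong (λ t → (iN ℚ.* iK) ℚ.* (fromℕ p - t)) (trans (cong fromℕ q≡) expand) ⟩
      (iN ℚ.* iK) ℚ.* (fromℕ p - (N ℚ.* W ℚ.+ K ℚ.* Δ ℚ.+ fromℕ p))
        ≡⟨ solveℚ 7 (λ iN iK N K W Δ P → (iN ⊛ iK) ⊛ (P ⊕ ⊝ (N ⊛ W ⊕ K ⊛ Δ ⊕ P))
                                          ≐ ⊝ ((iK ⊛ W) ⊛ (iN ⊛ N)) ⊕ ⊝ ((iN ⊛ Δ) ⊛ (iK ⊛ K)))
                    refl iN iK N K W Δ (fromℕ p) ⟩
      ℚ.- ((iK ℚ.* W) ℚ.* (iN ℚ.* N)) - (iN ℚ.* Δ) ℚ.* (iK ℚ.* K)
        ≡⟨ cong₂ (λ a b → ℚ.- ((iK ℚ.* W) ℚ.* a) - (iN ℚ.* Δ) ℚ.* b) (inv-inverse n 0<n) (inv-inverse k 0<k) ⟩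
      ℚ.- ((iK ℚ.* W) ℚ.* 1ℚ) - (iN ℚ.* Δ) ℚ.* 1ℚ
        ≡⟨ cong₂ (λ a b → ℚ.- a - b) (ℚ.*-identityʳ (iK ℚ.* W)) (ℚ.*-identityʳ (iN ℚ.* Δ)) ⟩
      ℚ.- (iK ℚ.* W) - iN ℚ.* Δ
        ∎)
    where
    open ≡-Reasoning
    iN = inv n
    iK = inv k
    N = fromℕ n
    K = fromℕ k
    W = fromℕ w
    Δ = fromℕ D
    expand : fromℕ (n * w + k * D + p) ≡ N ℚ.* W ℚ.+ K ℚ.* Δ ℚ.+ fromℕ p
    expand = trans (fromℕ-+ (n * w + k * D) p)
               (cong (ℚ._+ fromℕ p) (trans (fromℕ-+ (n * w) (k * D)) (cong₂ ℚ._+_ (fromℕ-* n w) (fromℕ-* k D))))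

module Coordinates {n} (J : Subset n) {k} (|J| : rank J n ≡ k) (0<k : 0 < k) (k<n : k < n) where

  open Blocks J using (π; d; runLenSum)
  open Roof J |J| 0<k k<n using (A; minW-formula)
  open Distance J |J| k<n using (distance-formula)

  -- c x = (P x - Q x) / (n k) is [x < π d] - (runLenSum (blk J x + 1) + rank J (π d)) / k
  -- - (n - 1 - x) / n + rankSum J / (n k).
  P Q : ℕ → ℕ
  P x = n * k * ind (x <ᵇ π d) + rankSum J
  Q x = n * (runLenSum (suc (blk J x)) + rank J (π d)) + k * (n ∸ suc x)

  ∑∈-P : ∀ I → rank I n ≡ k → ∑∈ I P ≡ n * k * rank I (π d) + k * rankSum J
  ∑∈-P I |I| = begin
    ∑∈ I P                                                          ≡⟨ ∑∈-distrib-+ I _ _ ⟩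
    ∑∈ I (λ x → n * k * ind (x <ᵇ π d)) + ∑∈ I (λ _ → rankSum J)    ≡⟨ cong₂ _+_ (∑∈-distribˡ-* I (n * k) _) (∑∈-const I _) ⟩
    n * k * ∑∈ I (λ x → ind (x <ᵇ π d)) + rank I n * rankSum J      ≡⟨ cong₂ (λ r s → n * k * r + s * rankSum J) (∑∈-<ᵇ I (π d) (Blocks.π≤n J d)) |I| ⟩
    n * k * rank I (π d) + k * rankSum J                            ∎
    where open ≡-Reasoning

  ∑∈-Q : ∀ I → rank I n ≡ k → ∑∈ I Q ≡ n * (A I + k * rank J (π d)) + k * rankSum I
  ∑∈-Q I |I| = begin
    ∑∈ I Q                                                              ≡⟨ ∑∈-distrib-+ I _ _ ⟩
    ∑∈ I (λ x → n * (runLenSum (suc (blk J x)) + rank J (π d))) + ∑∈ I (λ x → k * (n ∸ suc x))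
                                                                        ≡⟨ cong₂ _+_ (∑∈-distribˡ-* I n _) (∑∈-distribˡ-* I k _) ⟩
    n * ∑∈ I (λ x → runLenSum (suc (blk J x)) + rank J (π d)) + k * ∑∈ I (λ x → n ∸ suc x)
                                                                        ≡⟨ cong₂ (λ a b → n * a + k * b) (∑∈-distrib-+ I _ _) (sym (rankSum≡∑∈ I)) ⟩
    n * (A I + ∑∈ I (λ _ → rank J (π d))) + k * rankSum I               ≡⟨ cong (λ t → n * (A I + t) + k * rankSum I) (trans (∑∈-const I _) (cong (_* rank J (π d)) |I|)) ⟩
    n * (A I + k * rank J (π d)) + k * rankSum I                        ∎
    where open ≡-Reasoning

  core-identity : ∀ I {D} → rank I n ≡ k → IsDist n J I D → ∑∈ I Q ≡ n * minW J I + k * D + ∑∈ I P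
  core-identity I {D} |I| dist with excess-exists J I (<-trans 0<k k<n)
  ... | m , excess = begin
    ∑∈ I Q                                              ≡⟨ ∑∈-Q I |I| ⟩
    n * (A I + k * rJ) + k * rankSum I                  ≡⟨ cong (λ t → n * t + k * rankSum I) (minW-formula I |I| excess) ⟨
    n * (minW J I + k * m + k * rI) + k * rankSum I     ≡⟨ solve 6 (λ n k w m r s → n :* (w :+ k :* m :+ k :* r) :+ k :* s
                                                                    := n :* w :+ k :* (m :* n :+ s) :+ n :* k :* r)
                                                             refl n k (minW J I) m rI (rankSum I) ⟩
    n * minW J I + k * (m * n + rankSum I) + n * k * rI ≡⟨ cong (λ t → n * minW J I + k * t + n * k * rI) (distance-formula |I| excess dist) ⟨
    n * minW J I + k * (D + rankSum J) + n * k * rI     ≡⟨ solve 6 (λ n k w D s r → n :* w :+ k :* (D :+ s) :+ n :* k :* r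
                                                                    := n :* w :+ k :* D :+ (n :* k :* r :+ k :* s))
                                                             refl n k (minW J I) D (rankSum J) rI ⟩
    n * minW J I + k * D + (n * k * rI + k * rankSum J) ≡⟨ cong (n * minW J I + k * D +_) (∑∈-P I |I|) ⟨
    n * minW J I + k * D + ∑∈ I P                       ∎
    where
    open ≡-Reasoning
    rJ = rank J (π d)
    rI = rank I (π d)

open RationalCoordinates using (sumOver-scaled; scaled-difference)

mainTheorem18 : (n k : ℕ) → 2 ≤ k → k < n →
    (J : Subset n) → ∣ J ∣ ≡ k → ¬ IsCyclicInterval n k J →
    (dist : Subset n → ℕ) → (∀ I → ∣ I ∣ ≡ k → IsDist n J I (dist I)) →
    Σ (ℕ → ℚ) (λ c → ∀ (I : Subset n) → ∣ I ∣ ≡ k →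
    eta k J I - planarCoord n (dist I) ≡ sumOver I c)
mainTheorem18 n k 2≤k k<n J |J| _ dist isDist = c , coordinate
  where
  0<k : 0 < k
  0<k = <-trans z<s 2≤k
  open Coordinates J (trans (sym (∣∣≡rank J)) |J|) 0<k k<n
  c : ℕ → ℚ
  c x = (inv n ℚ.* inv k) ℚ.* (fromℕ (P x) - fromℕ (Q x))
  coordinate : ∀ I → ∣ I ∣ ≡ k → eta k J I - planarCoord n (dist I) ≡ sumOver I c
  coordinate I |I| = trans
    (scaled-difference n k (minW J I) (dist I) (∑∈ I P) (∑∈ I Q) (<-trans 0<k k<n) 0<k
      (core-identity I (trans (sym (∣∣≡rank I)) |I|) (isDist I |I|)))
    (sym (sumOver-scaled I (inv n ℚ.* inv k) P Q))
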